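{- Let $G=(V,E)$ be a graph. The minimum number of vertex splits needed to transform $G$ into a disjoint union of paths is \[\sum_{v\in V}\left(\left\lceil \frac{d(v)}{2}\right\rceil-1\right)+r,\] where $d(v)$ is the degree of $v$ in $G$ and $r$ is the number of connected components of $G$ that contain no vertex of odd degree.
   Context: All graphs are finite, simple and undirected. A (vertex) split of a vertex $v$ of a graph $G$ chooses sets $A,B\subseteq N_G(v)$ with $A\cup B=N_G(v)$ and replaces $v$ by two new vertices $v_1,v_2$, where $v_1$ is adjacent exactly to $A$ and $v_2$ exactly to $B$ (all other adjacencies unchanged). A split sequence applies splits one after another, each to a vertex of the current graph. -}

module Defs where

open import Data.Nat using (ℕ; zero; suc; _+_; _/_)
open import Data.Integer as ℤ using (ℤ; +_; _-_)
open import Data.Bool using (Bool; true; false; if_then_else_; _∨_)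
open import Data.Fin using (Fin; zero; suc; _≟_)
open import Data.Nat.ListAction using (sum)
open import Data.List using (List; []; _∷_; _++_; map; foldr; length; concat; allFin)
open import Data.List.Membership.Propositional using (_∈_)
open import Data.List.Relation.Binary.Permutation.Propositional using (_↭_)
open import Data.List.Relation.Unary.AllPairs using (AllPairs)
open import Data.Product using (Σ; ∃; _×_; _,_)
open import Data.Sum using (_⊎_)
open import Relation.Nullary using (¬_; yes; no)
open import Relation.Binary.PropositionalEquality using (_≡_; refl; sym; trans)

record Graph : Set where
  field
    n      : ℕ
    adj    : Fin n → Fin n → Bool
    adj-sym    : ∀ x y → adj x y ≡ adj y x
    adj-irrefl : ∀ x → adj x x ≡ false
open Graph public

-- adjacency after splitting v into v₁ (= suc v) and v₂ (= the new vertex zero);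
-- v₁ is adjacent exactly to A, v₂ exactly to B; other vertices x are suc x.
splitAdj : ∀ {n} → (Fin n → Fin n → Bool) → Fin n → (A B : Fin n → Bool)
         → Fin (suc n) → Fin (suc n) → Bool
splitAdj adj v A B zero    zero    = false
splitAdj adj v A B zero    (suc y) = B y
splitAdj adj v A B (suc x) zero    = B x
splitAdj adj v A B (suc x) (suc y) with x ≟ v | y ≟ v
... | yes _ | yes _ = false
... | yes _ | no  _ = A y
... | no  _ | yes _ = A x
... | no  _ | no  _ = adj x y

splitAdj-sym : ∀ {n} (adj : Fin n → Fin n → Bool) → (∀ x y → adj x y ≡ adj y x)
             → ∀ v A B x y → splitAdj adj v A B x y ≡ splitAdj adj v A B y x
splitAdj-sym adj s v A B zero zero = refl
splitAdj-sym adj s v A B zero (suc y) = refl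
splitAdj-sym adj s v A B (suc x) zero = refl
splitAdj-sym adj s v A B (suc x) (suc y) with x ≟ v | y ≟ v
... | yes _ | yes _ = refl
... | yes _ | no  _ = refl
... | no  _ | yes _ = refl
... | no  _ | no  _ = s x y

splitAdj-irrefl : ∀ {n} (adj : Fin n → Fin n → Bool) → (∀ x → adj x x ≡ false)
                → ∀ v A B x → splitAdj adj v A B x x ≡ false
splitAdj-irrefl adj i v A B zero = refl
splitAdj-irrefl adj i v A B (suc x) with x ≟ v
... | yes _ = refl
... | no  _ = i x

splitGraph : (G : Graph) → Fin (n G) → (A B : Fin (n G) → Bool) → Graph
splitGraph G v A B = record
  { n = suc (n G)
  ; adj = splitAdj (adj G) v A B
  ; adj-sym = splitAdj-sym (adj G) (adj-sym G) v A B
  ; adj-irrefl = splitAdj-irrefl (adj G) (adj-irrefl G) v A B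
  }

ValidSplit : (G : Graph) → Fin (n G) → (A B : Fin (n G) → Bool) → Set
ValidSplit G v A B =
  (∀ u → A u ≡ true → adj G v u ≡ true) ×
  (∀ u → B u ≡ true → adj G v u ≡ true) ×
  (∀ u → adj G v u ≡ true → (A u ≡ true ⊎ B u ≡ true))

data SplitSeq : Graph → ℕ → Graph → Set where
  done : ∀ {G} → SplitSeq G 0 G
  step : ∀ {G k H} (v : Fin (n G)) (A B : Fin (n G) → Bool)
       → ValidSplit G v A B
       → SplitSeq (splitGraph G v A B) k H
       → SplitSeq G (suc k) H

Consecutive : ∀ {m} → List (Fin m) → Fin m → Fin m → Set
Consecutive p u w = Σ _ λ xs → Σ _ λ ys → p ≡ xs ++ (u ∷ w ∷ ys)

infix 3 _⇔_
_⇔_ : Set → Set → Set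
P ⇔ Q = (P → Q) × (Q → P)

IsDisjointUnionOfPaths : Graph → Set
IsDisjointUnionOfPaths G =
  Σ (List (List (Fin (n G)))) λ ps →
    (concat ps ↭ allFin (n G)) ×
    (∀ u w → adj G u w ≡ true ⇔ (Σ (List (Fin (n G))) λ p → p ∈ ps × (Consecutive p u w ⊎ Consecutive p w u)))

deg : (G : Graph) → Fin (n G) → ℕ
deg G v = sum (map (λ w → if adj G v w then 1 else 0) (allFin (n G)))

data Connected (G : Graph) : Fin (n G) → Fin (n G) → Set where
  here  : ∀ {u} → Connected G u u
  there : ∀ {u w x} → adj G u w ≡ true → Connected G w x → Connected G u x

data Odd : ℕ → Set where
  one : Odd 1
  ss  : ∀ {k} → Odd k → Odd (suc (suc k))

EvenComponent : (G : Graph) → Fin (n G) → Set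
EvenComponent G v = ∀ w → Connected G v w → ¬ Odd (deg G w)

-- r is the number of connected components of G containing no vertex of odd
-- degree: witnessed by a list of representatives, one per such component.
NumEvenComponents : Graph → ℕ → Set
NumEvenComponents G r =
  Σ (List (Fin (n G))) λ reps →
    (length reps ≡ r) ×
    (∀ v → v ∈ reps → EvenComponent G v) ×
    AllPairs (λ u w → ¬ Connected G u w) reps ×
    (∀ w → EvenComponent G w → Σ (Fin (n G)) λ v → v ∈ reps × Connected G v w)

-- ⌈ d / 2 ⌉ - 1 as an integer
ceilHalfMinusOne : ℕ → ℤ
ceilHalfMinusOne d = (+ ((d + 1) / 2)) - (+ 1)

splitFormula : Graph → ℕ → ℤ
splitFormula G r =
  foldr ℤ._+_ (+ 0) (map (λ v → ceilHalfMinusOne (deg G v)) (allFin (n G))) ℤ.+ (+ r)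

{-# OPTIONS --safe #-}
-- Let r be the number of even components of G (components without a vertex of odd degree;
-- an isolated vertex is one) and Φ(G) = Σ_v ⌈d(v)/2⌉ + r. Every vertex contributes at least 1
-- to Φ (through its degree, or as an isolated even component), so Φ(G) ≥ n(G), and the claimed
-- minimum is Φ(G) − n(G).
--
-- A split adds one vertex and never lowers Φ. The halves ⌈d/2⌉ can only grow; and if v lies in
-- an even component that disappears, some half rounds up: at an even-degree vertex of A ∩ B, or
-- at v because |A| and |B| are both odd. In a union of paths every vertex contributes exactly 1,
-- so Φ = n there, and at least Φ(G) − n(G) splits are needed.
--
-- Conversely, if G is not yet a union of paths then either a vertex with an edge lies in an even
-- component, or some vertex has degree at least 3 (a graph of maximum degree 2 whose nontrivial
-- components all contain odd-degree vertices is a union of paths: peel off an edge at a vertex of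
-- degree 1). In the first case splitting off one neighbour makes both copies odd; in the second,
-- the handshake lemma finds odd-degree vertices that v₁ and v₂ can each reach without passing
-- through v. Either way Φ is unchanged, so Φ(G) − n(G) splits suffice.
module Submission where

open import Defs
open import Data.Nat as ℕ using (ℕ; zero; suc; _+_; _∸_; _≤_; _<_; _/_; z≤n; s≤s; _≤?_; ⌈_/2⌉; ⌊_/2⌋; parity)
open import Data.Nat.Properties hiding (_≟_)
open import Data.Nat.DivMod using (m/n≡1+[m∸n]/n)
open import Data.Nat.ListAction using (sum)
open import Data.Nat.Solver using (module +-*-Solver)
open import Data.Parity.Base as ℙ using (0ℙ; 1ℙ)
import Data.Parity.Properties as ℙ
import Data.Integer as ℤ
import Data.Integer.Properties as ℤₚ
import Data.Integer.Solver as ℤ-Solver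
open import Data.Bool using (Bool; true; false; _∧_; _∨_; not; if_then_else_)
import Data.Bool.Properties as Bool
open import Data.Fin using (Fin; zero; suc; punchIn; _≟_)
open import Data.Fin.Properties using (any?; all?; ¬∀⟶∃¬; punchInᵢ≢i)
open import Data.List
  using (List; []; _∷_; [_]; _++_; _∷ʳ_; map; foldr; length; tabulate; allFin; filter; concat; initLast; _∷ʳ′_)
open import Data.List.Properties
  using (∷-injective; ∷ʳ-injective; ++-assoc; length-++; length-map; length-tabulate; length-filter; filter-all;
         filter-notAll; concat-map-[_])
open import Data.List.Membership.Propositional using (_∈_; find)
open import Data.List.Membership.Propositional.Properties
  using (∈-filter⁺; ∈-filter⁻; ∈-map⁺; ∈-map⁻; ∈-allFin; ∈-++⁺ˡ; ∈-++⁺ʳ; ∈-concat⁻′; ∈-concat⁺′; ∈-∃++)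
open import Data.List.Relation.Unary.Any as Any using (here; there)
open import Data.List.Relation.Unary.All as All using (All; []; _∷_)
import Data.List.Relation.Unary.All.Properties as All
open import Data.List.Relation.Unary.All.Properties using (¬Any⇒All¬)
open import Data.List.Relation.Unary.AllPairs as AllPairs using (AllPairs; []; _∷_)
import Data.List.Relation.Unary.AllPairs.Properties as AllPairs
open import Data.List.Relation.Unary.Unique.Propositional using (Unique)
import Data.List.Relation.Unary.Unique.Propositional.Properties as Unique
open import Data.List.Relation.Binary.Permutation.Propositional as ↭ using (_↭_; ↭-sym; ↭⇒↭ₛ)
open import Data.List.Relation.Binary.Permutation.Propositional.Properties using (∈-resp-↭; shift; shifts; ++⁺ˡ)
import Data.List.Relation.Binary.Permutation.Setoid.Properties as Permutationₛ
open import Data.Product using (Σ; ∃; ∃₂; _×_; _,_; proj₁; proj₂)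
open import Data.Sum as Sum using (_⊎_; inj₁; inj₂; fromInj₂)
open import Data.Empty using (⊥; ⊥-elim)
open import Relation.Nullary using (¬_; Dec; yes; no; does; contradiction)
open import Relation.Nullary.Decidable using (map′; ¬?; _×-dec_; _⊎-dec_; _→-dec_; dec-true; dec-false; does-⇔)
open import Relation.Binary.PropositionalEquality hiding ([_])
open import Function using (_∘_; id; case_of_; mk⇔)
open import Algebra.Properties.CommutativeMonoid.Sum +-0-commutativeMonoid
  using (sum-remove; ∑-distrib-+; sum-cong-≗; sum-replicate-zero) renaming (sum to ∑)

-- Finite sums

𝟙 : Bool → ℕ
𝟙 b = if b then 1 else 0

𝟙-∨-∧ : ∀ a b → 𝟙 a + 𝟙 b ≡ 𝟙 (a ∨ b) + 𝟙 (a ∧ b)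
𝟙-∨-∧ true  true  = refl
𝟙-∨-∧ true  false = refl
𝟙-∨-∧ false true  = refl
𝟙-∨-∧ false false = refl

∑-mono-≤ : ∀ {k} {f g : Fin k → ℕ} → (∀ x → f x ≤ g x) → ∑ f ≤ ∑ g
∑-mono-≤ {zero}  f≤g = z≤n
∑-mono-≤ {suc k} f≤g = +-mono-≤ (f≤g zero) (∑-mono-≤ (f≤g ∘ suc))

∑-zero : ∀ {k} {f : Fin k → ℕ} → (∀ x → f x ≡ 0) → ∑ f ≡ 0
∑-zero {k} f≡0 = trans (sum-cong-≗ f≡0) (sum-replicate-zero k)

∑-const-1 : ∀ k → ∑ {k} (λ _ → 1) ≡ k
∑-const-1 zero    = refl
∑-const-1 (suc k) = cong suc (∑-const-1 k)

∑-≥ : ∀ {k} (f : Fin k → ℕ) x → f x ≤ ∑ f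
∑-≥ {suc k} f x = subst (f x ≤_) (sym (sum-remove {i = x} f)) (m≤m+n (f x) _)

∑-except-≤ : ∀ {k} {f g : Fin k → ℕ} v → (∀ x → x ≢ v → f x ≤ g x) → ∑ f + g v ≤ ∑ g + f v
∑-except-≤ {suc k} {f} {g} v f≤g = begin
  ∑ f + g v                              ≡⟨ cong (_+ g v) (sum-remove {i = v} f) ⟩
  f v + ∑ (f ∘ punchIn v) + g v          ≤⟨ +-monoˡ-≤ (g v) (+-monoʳ-≤ (f v) rest≤) ⟩
  f v + ∑ (g ∘ punchIn v) + g v          ≡⟨ solve 3 (λ a b c → a :+ b :+ c := c :+ b :+ a) refl (f v) _ (g v) ⟩
  g v + ∑ (g ∘ punchIn v) + f v          ≡⟨ cong (_+ f v) (sum-remove {i = v} g) ⟨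
  ∑ g + f v                              ∎
  where
  open ≤-Reasoning
  open +-*-Solver
  rest≤ : ∑ (f ∘ punchIn v) ≤ ∑ (g ∘ punchIn v)
  rest≤ = ∑-mono-≤ (λ x → f≤g (punchIn v x) (punchInᵢ≢i v x))

∑-except-≡ : ∀ {k} {f g : Fin k → ℕ} v → (∀ x → x ≢ v → f x ≡ g x) → ∑ f + g v ≡ ∑ g + f v
∑-except-≡ v f≡g = ≤-antisym (∑-except-≤ v (λ x x≢v → ≤-reflexive (f≡g x x≢v)))
                             (∑-except-≤ v (λ x x≢v → ≤-reflexive (sym (f≡g x x≢v))))

∑-single : ∀ {k} (f : Fin k → ℕ) v → (∀ x → x ≢ v → f x ≡ 0) → ∑ f ≡ f v
∑-single {suc k} f v f≡0 = begin
  ∑ f                           ≡⟨ sum-remove {i = v} f ⟩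
  f v + ∑ (f ∘ punchIn v)       ≡⟨ cong (f v +_) (∑-zero (λ x → f≡0 (punchIn v x) (punchInᵢ≢i v x))) ⟩
  f v + 0                       ≡⟨ +-identityʳ (f v) ⟩
  f v                           ∎
  where open ≡-Reasoning

∑-indicator : ∀ {k} (a : Fin k) → ∑ (λ x → 𝟙 (does (x ≟ a))) ≡ 1
∑-indicator a = trans (∑-single _ a x≢a⇒0) (a≡a⇒1 (a ≟ a))
  where
  x≢a⇒0 : ∀ x → x ≢ a → 𝟙 (does (x ≟ a)) ≡ 0
  x≢a⇒0 x x≢a with x ≟ a
  ... | yes x≡a = contradiction x≡a x≢a
  ... | no _    = refl
  a≡a⇒1 : (d : Dec (a ≡ a)) → 𝟙 (does d) ≡ 1
  a≡a⇒1 (yes _)  = refl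
  a≡a⇒1 (no a≢a) = contradiction refl a≢a

∑-< : ∀ {k} {f g : Fin k → ℕ} a → (∀ x → f x ≤ g x) → f a < g a → ∑ f < ∑ g
∑-< {suc k} {f} {g} a f≤g fa<ga = begin-strict
  ∑ f                       ≡⟨ sum-remove {i = a} f ⟩
  f a + ∑ (f ∘ punchIn a)   <⟨ +-mono-<-≤ fa<ga (∑-mono-≤ (f≤g ∘ punchIn a)) ⟩
  g a + ∑ (g ∘ punchIn a)   ≡⟨ sum-remove {i = a} g ⟨
  ∑ g                       ∎
  where open ≤-Reasoning

∑-except-< : ∀ {k} {f g : Fin k → ℕ} v a → a ≢ v → (∀ x → x ≢ v → f x ≤ g x) → f a < g a →
  suc (∑ f + g v) ≤ ∑ g + f v
∑-except-< {k} {f} {g} v a a≢v f≤g fa<ga = begin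
  suc (∑ f + g v)         ≡⟨ solve 2 (λ s t → con 1 :+ (s :+ t) := s :+ con 1 :+ t) refl (∑ f) (g v) ⟩
  ∑ f + 1 + g v           ≡⟨ cong (λ s → ∑ f + s + g v) (∑-indicator a) ⟨
  ∑ f + ∑ is-a + g v      ≡⟨ cong (_+ g v) (∑-distrib-+ f is-a) ⟨
  ∑ f′ + g v              ≤⟨ ∑-except-≤ v f′≤g ⟩
  ∑ g + (f v + is-a v)    ≡⟨ cong (λ s → ∑ g + (f v + 𝟙 s)) (dec-false (v ≟ a) (a≢v ∘ sym)) ⟩
  ∑ g + (f v + 0)         ≡⟨ cong (∑ g +_) (+-identityʳ (f v)) ⟩
  ∑ g + f v               ∎
  where
  open ≤-Reasoning
  open +-*-Solver
  is-a f′ : Fin k → ℕ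
  is-a x = 𝟙 (does (x ≟ a))
  f′ x = f x + is-a x
  f′≤g : ∀ x → x ≢ v → f′ x ≤ g x
  f′≤g x x≢v with x ≟ a
  ... | yes refl = subst (_≤ g x) (+-comm 1 (f x)) fa<ga
  ... | no _     = subst (_≤ g x) (sym (+-identityʳ (f x))) (f≤g x x≢v)

sum-map-tabulate : ∀ {k} {A : Set} (g : Fin k → A) (f : A → ℕ) → sum (map f (tabulate g)) ≡ ∑ (f ∘ g)
sum-map-tabulate {zero}  g f = refl
sum-map-tabulate {suc k} g f = cong (f (g zero) +_) (sum-map-tabulate (g ∘ suc) f)

-- Parity and halves

Odd⇒parity≡1ℙ : ∀ {k} → Odd k → parity k ≡ 1ℙ
Odd⇒parity≡1ℙ one    = refl
Odd⇒parity≡1ℙ (ss o) = Odd⇒parity≡1ℙ o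

parity≡1ℙ⇒Odd : ∀ k → parity k ≡ 1ℙ → Odd k
parity≡1ℙ⇒Odd zero          ()
parity≡1ℙ⇒Odd (suc zero)    _  = one
parity≡1ℙ⇒Odd (suc (suc k)) eq = ss (parity≡1ℙ⇒Odd k eq)

odd? : ∀ k → Dec (Odd k)
odd? k = map′ (parity≡1ℙ⇒Odd k) Odd⇒parity≡1ℙ (parity k ℙ.≟ 1ℙ)

¬Odd⇒parity≡0ℙ : ∀ {k} → ¬ Odd k → parity k ≡ 0ℙ
¬Odd⇒parity≡0ℙ {k} ¬odd with parity k in eq
... | 0ℙ = refl
... | 1ℙ = contradiction (parity≡1ℙ⇒Odd k eq) ¬odd

parity≡0ℙ⇒¬Odd : ∀ {k} → parity k ≡ 0ℙ → ¬ Odd k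
parity≡0ℙ⇒¬Odd eq odd with trans (sym eq) (Odd⇒parity≡1ℙ odd)
... | ()

¬Odd-suc⇒Odd : ∀ {k} → ¬ Odd (suc k) → Odd k
¬Odd-suc⇒Odd {k} ¬odd = parity≡1ℙ⇒Odd k (trans (sym (ℙ.suc-homo-⁻¹ k)) (cong ℙ._⁻¹ (¬Odd⇒parity≡0ℙ ¬odd)))

Odd-suc⇒¬Odd : ∀ {k} → Odd (suc k) → ¬ Odd k
Odd-suc⇒¬Odd {k} odd-suc = parity≡0ℙ⇒¬Odd (trans (sym (ℙ.suc-homo-⁻¹ k)) (cong ℙ._⁻¹ (Odd⇒parity≡1ℙ odd-suc)))

parity-+≡0ℙ : ∀ a b → parity (a + b) ≡ 0ℙ → parity a ≡ parity b
parity-+≡0ℙ a b even rewrite ℙ.+-homo-+ a b with parity a | parity b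
... | 0ℙ | 0ℙ = refl
... | 1ℙ | 1ℙ = refl
... | 0ℙ | 1ℙ = contradiction even λ ()
... | 1ℙ | 0ℙ = contradiction even λ ()

⌈/2⌉-+-≤ : ∀ a b → ⌈ a + b /2⌉ ≤ ⌈ a /2⌉ + ⌈ b /2⌉
⌈/2⌉-+-≤ zero          b = ≤-refl
⌈/2⌉-+-≤ (suc zero)    b = s≤s (⌊n/2⌋≤⌈n/2⌉ b)
⌈/2⌉-+-≤ (suc (suc a)) b = s≤s (⌈/2⌉-+-≤ a b)

⌈suc/2⌉-even : ∀ k → parity k ≡ 0ℙ → ⌈ suc k /2⌉ ≡ suc ⌈ k /2⌉
⌈suc/2⌉-even zero          _  = refl
⌈suc/2⌉-even (suc zero)    ()
⌈suc/2⌉-even (suc (suc k)) eq = cong suc (⌈suc/2⌉-even k eq)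

suc⌊/2⌋-odd : ∀ {b} → Odd b → suc ⌊ b /2⌋ ≡ ⌈ b /2⌉
suc⌊/2⌋-odd one    = refl
suc⌊/2⌋-odd (ss o) = cong suc (suc⌊/2⌋-odd o)

⌈/2⌉-+-odd : ∀ {a b} → Odd a → Odd b → suc ⌈ a + b /2⌉ ≡ ⌈ a /2⌉ + ⌈ b /2⌉
⌈/2⌉-+-odd one    ob = cong suc (suc⌊/2⌋-odd ob)
⌈/2⌉-+-odd (ss oa) ob = cong suc (⌈/2⌉-+-odd oa ob)

[n+1]/2≡⌈n/2⌉ : ∀ d → (d + 1) / 2 ≡ ⌈ d /2⌉
[n+1]/2≡⌈n/2⌉ zero          = refl
[n+1]/2≡⌈n/2⌉ (suc zero)    = refl
[n+1]/2≡⌈n/2⌉ (suc (suc d)) =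
  trans (m/n≡1+[m∸n]/n {suc (suc d) + 1} {2} (s≤s (s≤s z≤n))) (cong suc ([n+1]/2≡⌈n/2⌉ d))


-- Degrees and connectivity

length-filter-tabulate : ∀ {k} {A : Set} {P : A → Set} (P? : ∀ a → Dec (P a)) (g : Fin k → A) →
  length (filter P? (tabulate g)) ≡ ∑ (λ x → 𝟙 (does (P? (g x))))
length-filter-tabulate {zero}  P? g = refl
length-filter-tabulate {suc k} P? g with P? (g zero)
... | yes _ = cong suc (length-filter-tabulate P? (g ∘ suc))
... | no  _ = length-filter-tabulate P? (g ∘ suc)

length-≤-by-distinct-witnesses : ∀ {A : Set} {k} (T : A → Fin k → Set) (X : List A) (M : List (Fin k)) →
  AllPairs (λ x y → ∀ m → T x m → T y m → ⊥) X →
  (∀ x → x ∈ X → ∃ λ m → m ∈ M × T x m) → length X ≤ length M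
length-≤-by-distinct-witnesses T []      M _ _ = z≤n
length-≤-by-distinct-witnesses T (x ∷ X) M (x-distinct ∷ X-distinct) witness
  with witness x (here refl)
... | m₀ , m₀∈M , Txm₀ = ≤-trans (s≤s (length-≤-by-distinct-witnesses T X M′ X-distinct witness′)) M′<M
  where
  P? = λ m → ¬? (m ≟ m₀)
  M′ = filter P? M
  M′<M : length M′ < length M
  M′<M = filter-notAll P? M (Any.map (λ m≡m₀ m≢m₀ → m≢m₀ (sym m≡m₀)) m₀∈M)
  witness′ : ∀ y → y ∈ X → ∃ λ m → m ∈ M′ × T y m
  witness′ y y∈X with witness y (there y∈X)
  ... | m , m∈M , Tym with m ≟ m₀
  ...   | yes refl = contradiction Tym (All.lookup x-distinct y∈X m₀ Txm₀)
  ...   | no m≢m₀  = m , ∈-filter⁺ P? m∈M m≢m₀ , Tym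

length-unique-≤ : ∀ {k} (X : List (Fin k)) → Unique X → length X ≤ k
length-unique-≤ {k} X unique = subst (length X ≤_) (length-tabulate id)
  (length-≤-by-distinct-witnesses _≡_ X (allFin k)
    (AllPairs.map (λ x≢y m x≡m y≡m → x≢y (trans x≡m (sym y≡m))) unique)
    (λ x _ → x , ∈-allFin x , refl))

∑𝟙≤length : ∀ {k} (b : Fin k → Bool) (cs : List (Fin k)) → (∀ y → b y ≡ true → y ∈ cs) → ∑ (𝟙 ∘ b) ≤ length cs
∑𝟙≤length {k} b cs b⊆cs = subst (_≤ length cs) length-X
  (length-≤-by-distinct-witnesses _≡_ X cs
    (AllPairs.map (λ x≢y m x≡m y≡m → x≢y (trans x≡m (sym y≡m))) (Unique.filter⁺ P? (Unique.allFin⁺ k)))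
    (λ x x∈X → x , b⊆cs x (proj₂ (∈-filter⁻ P? {xs = allFin k} x∈X)) , refl))
  where
  P? = λ y → b y Bool.≟ true
  X = filter P? (allFin k)
  𝟙-≟true : ∀ c → 𝟙 (does (c Bool.≟ true)) ≡ 𝟙 c
  𝟙-≟true true  = refl
  𝟙-≟true false = refl
  length-X : length X ≡ ∑ (𝟙 ∘ b)
  length-X = trans (length-filter-tabulate P? id) (sum-cong-≗ (𝟙-≟true ∘ b))

module _ (G : Graph) where

  private
    V = Fin (n G)

  adj-flip : ∀ {x y} → adj G x y ≡ true → adj G y x ≡ true
  adj-flip {x} {y} xy = trans (adj-sym G y x) xy

  adj⇒≢ : ∀ {x y} → adj G x y ≡ true → x ≢ y
  adj⇒≢ {x} xy refl with trans (sym xy) (adj-irrefl G x)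
  ... | ()

  deg≡∑ : ∀ v → deg G v ≡ ∑ (λ w → 𝟙 (adj G v w))
  deg≡∑ v = sum-map-tabulate id (𝟙 ∘ adj G v)

  adj⇒1≤deg : ∀ {v w} → adj G v w ≡ true → 1 ≤ deg G v
  adj⇒1≤deg {v} {w} vw = subst (1 ≤_) (sym (deg≡∑ v))
    (≤-trans (≤-reflexive (cong 𝟙 (sym vw))) (∑-≥ (𝟙 ∘ adj G v) w))

  1≤deg⇒adj : ∀ v → 1 ≤ deg G v → ∃ λ w → adj G v w ≡ true
  1≤deg⇒adj v 1≤d with any? (λ w → adj G v w Bool.≟ true)
  ... | yes nbr = nbr
  ... | no ¬nbr = contradiction (subst (1 ≤_) (trans (deg≡∑ v) (∑-zero no-edge)) 1≤d) (λ ())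
    where
    no-edge : ∀ w → 𝟙 (adj G v w) ≡ 0
    no-edge w = cong 𝟙 (Bool.¬-not (¬nbr ∘ (w ,_)))

  deg≤length : ∀ v (cs : List V) → (∀ w → adj G v w ≡ true → w ∈ cs) → deg G v ≤ length cs
  deg≤length v cs nbrs⊆cs = subst (_≤ length cs) (sym (deg≡∑ v)) (∑𝟙≤length (adj G v) cs nbrs⊆cs)

  2≤deg : ∀ {x a b} → adj G x a ≡ true → adj G x b ≡ true → a ≢ b → 2 ≤ deg G x
  2≤deg {x} {a} {b} xa xb a≢b = subst (2 ≤_) (sym (deg≡∑ x)) (begin
    2                                   ≡⟨ cong₂ _+_ (∑-indicator a) (∑-indicator b) ⟨
    ∑ (is a) + ∑ (is b)                 ≡⟨ ∑-distrib-+ (is a) (is b) ⟨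
    ∑ (λ y → is a y + is b y)           ≤⟨ ∑-mono-≤ at-most-adj ⟩
    ∑ (λ y → 𝟙 (adj G x y))             ∎)
    where
    open ≤-Reasoning
    is : V → V → ℕ
    is z y = 𝟙 (does (y ≟ z))
    at-most-adj : ∀ y → is a y + is b y ≤ 𝟙 (adj G x y)
    at-most-adj y with y ≟ a | y ≟ b
    ... | yes refl | yes refl = contradiction refl a≢b
    ... | yes refl | no _     = ≤-reflexive (cong 𝟙 (sym xa))
    ... | no _     | yes refl = ≤-reflexive (cong 𝟙 (sym xb))
    ... | no _     | no _     = z≤n

  3≤deg⇒third-neighbour : ∀ v → 3 ≤ deg G v → ∀ p q → ∃ λ c → adj G v c ≡ true × c ≢ p × c ≢ q
  3≤deg⇒third-neighbour v 3≤d p q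
    with any? (λ c → (adj G v c Bool.≟ true) ×-dec (¬? (c ≟ p) ×-dec ¬? (c ≟ q)))
  ... | yes third = third
  ... | no ¬third = contradiction (≤-trans 3≤d (deg≤length v (p ∷ q ∷ []) nbrs⊆pq)) (λ { (s≤s (s≤s ())) })
    where
    nbrs⊆pq : ∀ y → adj G v y ≡ true → y ∈ p ∷ q ∷ []
    nbrs⊆pq y vy with y ≟ p | y ≟ q
    ... | yes y≡p | _       = here y≡p
    ... | no _    | yes y≡q = there (here y≡q)
    ... | no y≢p  | no y≢q  = contradiction (y , vy , y≢p , y≢q) ¬third

  Connected-trans : ∀ {u w x} → Connected G u w → Connected G w x → Connected G u x
  Connected-trans here          wx = wx
  Connected-trans (there uy yw) wx = there uy (Connected-trans yw wx)

  Connected-sym : ∀ {u w} → Connected G u w → Connected G w u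
  Connected-sym here          = here
  Connected-sym (there uy yw) = Connected-trans (Connected-sym yw) (there (adj-flip uy) here)

  adj⇒Connected : ∀ {u w} → adj G u w ≡ true → Connected G u w
  adj⇒Connected uw = there uw here

  deg≡0⇒Connected⇒≡ : ∀ {v w} → deg G v ≡ 0 → Connected G v w → v ≡ w
  deg≡0⇒Connected⇒≡ d≡0 here         = refl
  deg≡0⇒Connected⇒≡ d≡0 (there vy _) = contradiction (subst (1 ≤_) d≡0 (adj⇒1≤deg vy)) (λ ())

  EvenComponent-resp : ∀ {u w} → Connected G u w → EvenComponent G u → EvenComponent G w
  EvenComponent-resp uw even x wx = even x (Connected-trans uw wx)

  -- Deciding connectivity: a walk can be shortened until its vertices are distinct, and
  -- then it has at most n G steps, a bound under which walks can be searched exhaustively.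
  walkVertices : ∀ {u w} → Connected G u w → List V
  walkVertices here            = []
  walkVertices (there {u} _ c) = u ∷ walkVertices c

  private
    dropUntil : ∀ {x w u} (c : Connected G x w) → u ∈ walkVertices c →
      Σ (Connected G u w) λ c′ → Unique (walkVertices c) → Unique (walkVertices c′)
    dropUntil (there e c) (here refl) = there e c , id
    dropUntil (there e c) (there u∈c) with dropUntil c u∈c
    ... | c′ , keeps = c′ , λ { (_ ∷ unique) → keeps unique }

  simpleWalk : ∀ {u w} → Connected G u w → Σ (Connected G u w) (Unique ∘ walkVertices)
  simpleWalk here = here , []
  simpleWalk (there {u} e c) with simpleWalk c
  ... | c₁ , unique with Any.any? (u ≟_) (walkVertices c₁)
  ...   | yes u∈c₁ = let (c₂ , keeps) = dropUntil c₁ u∈c₁ in c₂ , keeps unique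
  ...   | no  u∉c₁ = there e c₁ , ¬Any⇒All¬ _ u∉c₁ ∷ unique

  data ConnectedWithin : ℕ → V → V → Set where
    here  : ∀ {k u} → ConnectedWithin k u u
    there : ∀ {k u x w} → adj G u x ≡ true → ConnectedWithin k x w → ConnectedWithin (suc k) u w

  private
    within⇒Connected : ∀ {k u w} → ConnectedWithin k u w → Connected G u w
    within⇒Connected here        = here
    within⇒Connected (there e c) = there e (within⇒Connected c)

    Connected⇒within : ∀ {k u w} (c : Connected G u w) → length (walkVertices c) ≤ k → ConnectedWithin k u w
    Connected⇒within here        _         = here
    Connected⇒within (there e c) (s≤s len) = there e (Connected⇒within c len)

    within? : ∀ k u w → Dec (ConnectedWithin k u w)
    within? k u w with u ≟ w
    within? k       u w | yes refl = yes here
    within? zero    u w | no u≢w   = no λ { here → u≢w refl }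
    within? (suc k) u w | no u≢w
      with any? (λ x → (adj G u x Bool.≟ true) ×-dec within? k x w)
    ... | yes (x , ux , xw) = yes (there ux xw)
    ... | no ¬step          = no λ { here → u≢w refl ; (there ux xw) → ¬step (_ , ux , xw) }

  Connected? : ∀ u w → Dec (Connected G u w)
  Connected? u w with within? (n G) u w
  ... | yes c = yes (within⇒Connected c)
  ... | no ¬c = no λ c → let (c′ , unique) = simpleWalk c in
                         ¬c (Connected⇒within c′ (length-unique-≤ _ unique))

  EvenComponent? : ∀ v → Dec (EvenComponent G v)
  EvenComponent? v = all? (λ w → Connected? v w →-dec ¬? (odd? (deg G w)))

  ¬EvenComponent⇒odd : ∀ v → ¬ EvenComponent G v → ∃ λ o → Connected G v o × Odd (deg G o)
  ¬EvenComponent⇒odd v ¬even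
    with ¬∀⟶∃¬ (n G) _ (λ w → Connected? v w →-dec ¬? (odd? (deg G w))) ¬even
  ... | o , ¬[vo⇒even] with Connected? v o | odd? (deg G o)
  ...   | yes vo | yes odd  = o , vo , odd
  ...   | yes vo | no ¬odd  = contradiction (λ _ → ¬odd) ¬[vo⇒even]
  ...   | no ¬vo | _        = contradiction (λ vo → contradiction vo ¬vo) ¬[vo⇒even]

-- Even components and the potential

module _ (G : Graph) where

  private
    V = Fin (n G)
    Disconnected = λ (u w : V) → ¬ Connected G u w
    Represented = λ (reps : List V) (w : V) → ∃ λ ρ → ρ ∈ reps × Connected G ρ w

    Covered : List V → List V → Set
    Covered xs reps = ∀ w → EvenComponent G w → w ∈ xs ⊎ Represented reps w

    advance : ∀ {x xs reps reps′} → (∀ {w} → Represented reps w → Represented reps′ w) →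
      (EvenComponent G x → Represented reps′ x) → Covered (x ∷ xs) reps → Covered xs reps′
    advance grow settle-x covered w even-w with covered w even-w
    ... | inj₁ (here refl)  = inj₂ (settle-x even-w)
    ... | inj₁ (there w∈xs) = inj₁ w∈xs
    ... | inj₂ represented  = inj₂ (grow represented)

    collectRepresentatives : (reps : List V) → All (EvenComponent G) reps → AllPairs Disconnected reps →
      (xs : List V) → Covered xs reps →
      Σ (List V) λ reps′ → All (EvenComponent G) reps′ × AllPairs Disconnected reps′ ×
                           (∀ w → EvenComponent G w → Represented reps′ w)
    collectRepresentatives reps even disc [] covered =
      reps , even , disc , λ w even-w → fromInj₂ (λ ()) (covered w even-w)
    collectRepresentatives reps even disc (x ∷ xs) covered
      with EvenComponent? G x | Any.any? (Connected? G x) reps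
    ... | yes even-x | no ¬x~reps =
      collectRepresentatives (x ∷ reps) (even-x ∷ even) (¬Any⇒All¬ _ ¬x~reps ∷ disc) xs
        (advance (λ (ρ , ρ∈ , ρw) → ρ , there ρ∈ , ρw) (λ _ → x , here refl , here) covered)
    ... | yes _ | yes x~reps =
      collectRepresentatives reps even disc xs
        (advance id (λ _ → let (ρ , ρ∈ , xρ) = find x~reps in ρ , ρ∈ , Connected-sym G xρ) covered)
    ... | no ¬even-x | _ =
      collectRepresentatives reps even disc xs (advance id (λ even-x → contradiction even-x ¬even-x) covered)

  numEvenComponents : ∃ (NumEvenComponents G)
  numEvenComponents with collectRepresentatives [] [] [] (allFin (n G)) (λ w _ → inj₁ (∈-allFin w))
  ... | reps , even , disc , covered = length reps , reps , refl , (λ _ → All.lookup even) , disc , covered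

  private
    disconnected⇒distinct : ∀ {xs} → AllPairs Disconnected xs →
      AllPairs (λ x y → ∀ m → Connected G x m → Connected G y m → ⊥) xs
    disconnected⇒distinct = AllPairs.map (λ ¬xy m xm ym → ¬xy (Connected-trans G xm (Connected-sym G ym)))

  ≤numEvenComponents : ∀ {r} → NumEvenComponents G r → (L : List V) →
    AllPairs Disconnected L → (∀ x → x ∈ L → EvenComponent G x) → length L ≤ r
  ≤numEvenComponents (reps , refl , _ , _ , covered) L disc even =
    length-≤-by-distinct-witnesses (Connected G) L reps (disconnected⇒distinct disc)
      λ x x∈L → let (ρ , ρ∈reps , ρx) = covered x (even x x∈L) in ρ , ρ∈reps , Connected-sym G ρx

  numEvenComponents≤ : ∀ {r} → NumEvenComponents G r → (M : List V) →
    (∀ w → EvenComponent G w → ∃ λ m → m ∈ M × Connected G w m) → r ≤ length M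
  numEvenComponents≤ (reps , refl , even , disc , _) M covered =
    length-≤-by-distinct-witnesses (Connected G) reps M (disconnected⇒distinct disc)
      λ x x∈reps → covered x (even x x∈reps)

∑⌈deg/2⌉ : Graph → ℕ
∑⌈deg/2⌉ G = ∑ (λ v → ⌈ deg G v /2⌉)

isolated : (G : Graph) → List (Fin (n G))
isolated G = filter (λ v → deg G v ℕ.≟ 0) (allFin (n G))

length-isolated : ∀ G → length (isolated G) ≡ ∑ (λ v → 𝟙 (does (deg G v ℕ.≟ 0)))
length-isolated G = length-filter-tabulate (λ v → deg G v ℕ.≟ 0) id

1≤⌈d/2⌉+[d≡0] : ∀ d → 1 ≤ ⌈ d /2⌉ + 𝟙 (does (d ℕ.≟ 0))
1≤⌈d/2⌉+[d≡0] zero          = s≤s z≤n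
1≤⌈d/2⌉+[d≡0] (suc zero)    = s≤s z≤n
1≤⌈d/2⌉+[d≡0] (suc (suc d)) = s≤s z≤n

n≤∑⌈deg/2⌉+r : ∀ G {r} → NumEvenComponents G r → n G ≤ ∑⌈deg/2⌉ G + r
n≤∑⌈deg/2⌉+r G {r} N = begin
  n G                                                          ≡⟨ ∑-const-1 (n G) ⟨
  ∑ {n G} (λ _ → 1)                                            ≤⟨ ∑-mono-≤ (λ v → 1≤⌈d/2⌉+[d≡0] (deg G v)) ⟩
  ∑ (λ v → ⌈ deg G v /2⌉ + 𝟙 (does (deg G v ℕ.≟ 0)))     ≡⟨ ∑-distrib-+ (λ v → ⌈ deg G v /2⌉) _ ⟩
  ∑⌈deg/2⌉ G + ∑ (λ v → 𝟙 (does (deg G v ℕ.≟ 0)))        ≡⟨ cong (∑⌈deg/2⌉ G +_) (length-isolated G) ⟨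
  ∑⌈deg/2⌉ G + length (isolated G)                             ≤⟨ +-monoʳ-≤ (∑⌈deg/2⌉ G) isolated≤r ⟩
  ∑⌈deg/2⌉ G + r                                               ∎
  where
  open ≤-Reasoning
  deg≡0 : ∀ {v} → v ∈ isolated G → deg G v ≡ 0
  deg≡0 v∈ = proj₂ (∈-filter⁻ (λ v → deg G v ℕ.≟ 0) {xs = allFin (n G)} v∈)
  disconnected : ∀ {xs} → All (λ v → deg G v ≡ 0) xs → Unique xs → AllPairs (λ u w → ¬ Connected G u w) xs
  disconnected []            []                = []
  disconnected (d≡0 ∷ d≡0s) (u∉xs ∷ unique) =
    All.zipWith (λ (u≢w , _) uw → u≢w (deg≡0⇒Connected⇒≡ G d≡0 uw)) (u∉xs , d≡0s) ∷ disconnected d≡0s unique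
  even : ∀ v → v ∈ isolated G → EvenComponent G v
  even v v∈ w vw with deg≡0⇒Connected⇒≡ G (deg≡0 v∈) vw
  ... | refl = λ odd → case subst Odd (deg≡0 v∈) odd of λ ()
  isolated≤r : length (isolated G) ≤ r
  isolated≤r = ≤numEvenComponents G N (isolated G)
    (disconnected (All.tabulate deg≡0) (Unique.filter⁺ _ (Unique.allFin⁺ (n G)))) even

-- Splitting a vertex

module Splitting (G : Graph) (v : Fin (n G)) (A B : Fin (n G) → Bool) (valid : ValidSplit G v A B) where

  G′ : Graph
  G′ = splitGraph G v A B

  private
    V  = Fin (n G)
    V′ = Fin (suc (n G))

  π : V′ → V
  π zero    = v
  π (suc x) = x

  A⇒adj : ∀ u → A u ≡ true → adj G v u ≡ true
  A⇒adj = proj₁ valid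

  B⇒adj : ∀ u → B u ≡ true → adj G v u ≡ true
  B⇒adj = proj₁ (proj₂ valid)

  adj≡A∨B : ∀ y → adj G v y ≡ A y ∨ B y
  adj≡A∨B y with adj G v y in vy | A y in Ay | B y in By
  ... | true  | true  | _     = refl
  ... | true  | false | true  = refl
  ... | true  | false | false with proj₂ (proj₂ valid) y vy
  ...   | inj₁ Ay≡true = trans (sym Ay≡true) Ay
  ...   | inj₂ By≡true = trans (sym By≡true) By
  adj≡A∨B y | false | true | _ = trans (sym vy) (A⇒adj y Ay)
  adj≡A∨B y | false | false | true = trans (sym vy) (B⇒adj y By)
  adj≡A∨B y | false | false | false = refl

  A-v : A v ≡ false
  A-v = Bool.¬-not λ Av → adj⇒≢ G (A⇒adj v Av) refl

  adj′-other : ∀ {x y} → x ≢ v → y ≢ v → adj G′ (suc x) (suc y) ≡ adj G x y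
  adj′-other {x} {y} x≢v y≢v with x ≟ v | y ≟ v
  ... | yes x≡v | _       = contradiction x≡v x≢v
  ... | no _    | yes y≡v = contradiction y≡v y≢v
  ... | no _    | no _    = refl

  adj′-v₁ : ∀ {y} → y ≢ v → adj G′ (suc v) (suc y) ≡ A y
  adj′-v₁ {y} y≢v with v ≟ v | y ≟ v
  ... | no v≢v | _       = contradiction refl v≢v
  ... | yes _  | yes y≡v = contradiction y≡v y≢v
  ... | yes _  | no _    = refl

  adj′-to-v₁ : ∀ {x} → x ≢ v → adj G′ (suc x) (suc v) ≡ A x
  adj′-to-v₁ {x} x≢v = trans (adj-sym G′ (suc x) (suc v)) (adj′-v₁ x≢v)

  π-adj : ∀ x y → adj G′ x y ≡ true → adj G (π x) (π y) ≡ true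
  π-adj zero    zero    ()
  π-adj zero    (suc y) xy = B⇒adj y xy
  π-adj (suc x) zero    xy = adj-flip G (B⇒adj x xy)
  π-adj (suc x) (suc y) xy with x ≟ v | y ≟ v
  π-adj (suc x) (suc y) () | yes refl | yes refl
  ... | yes refl | no _    = A⇒adj y xy
  ... | no _    | yes refl = adj-flip G (A⇒adj x xy)
  ... | no _    | no _     = xy

  π-Connected : ∀ {x y} → Connected G′ x y → Connected G (π x) (π y)
  π-Connected here                 = here
  π-Connected (there {x} {y} xy c) = there (π-adj x y xy) (π-Connected c)

  |A| |B| : ℕ
  |A| = ∑ (𝟙 ∘ A)
  |B| = ∑ (𝟙 ∘ B)

  deg-v₂ : deg G′ zero ≡ |B|
  deg-v₂ = deg≡∑ G′ zero

  deg-v₁ : deg G′ (suc v) ≡ |A|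
  deg-v₁ = trans (deg≡∑ G′ (suc v)) (cong₂ _+_ (cong 𝟙 B-v) (sum-cong-≗ adj′-v₁≗A))
    where
    B-v : B v ≡ false
    B-v = Bool.¬-not λ Bv → adj⇒≢ G (B⇒adj v Bv) refl
    adj′-v₁≗A : ∀ y → 𝟙 (adj G′ (suc v) (suc y)) ≡ 𝟙 (A y)
    adj′-v₁≗A y = by-cases (y ≟ v)
      where
      by-cases : Dec (y ≡ v) → 𝟙 (adj G′ (suc v) (suc y)) ≡ 𝟙 (A y)
      by-cases (yes refl) = cong 𝟙 (trans (adj-irrefl G′ (suc v)) (sym A-v))
      by-cases (no y≢v)   = cong 𝟙 (adj′-v₁ y≢v)

  deg-other : ∀ {x} → x ≢ v → deg G′ (suc x) ≡ deg G x + 𝟙 (A x ∧ B x)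
  deg-other {x} x≢v = +-cancelʳ-≡ _ _ _ (begin
    deg G′ (suc x) + f v                  ≡⟨ cong (_+ f v) (deg≡∑ G′ (suc x)) ⟩
    𝟙 (B x) + ∑ g + f v                   ≡⟨ +-assoc (𝟙 (B x)) (∑ g) (f v) ⟩
    𝟙 (B x) + (∑ g + f v)                 ≡⟨ cong (𝟙 (B x) +_) (∑-except-≡ v (λ y y≢v → cong 𝟙 (sym (adj′-other x≢v y≢v)))) ⟨
    𝟙 (B x) + (∑ f + g v)                 ≡⟨ cong (λ a → 𝟙 (B x) + (∑ f + 𝟙 a)) (adj′-to-v₁ x≢v) ⟩
    𝟙 (B x) + (∑ f + 𝟙 (A x))             ≡⟨ solve 3 (λ b s a → b :+ (s :+ a) := s :+ (a :+ b)) refl (𝟙 (B x)) (∑ f) (𝟙 (A x)) ⟩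
    ∑ f + (𝟙 (A x) + 𝟙 (B x))             ≡⟨ cong (∑ f +_) (𝟙-∨-∧ (A x) (B x)) ⟩
    ∑ f + (𝟙 (A x ∨ B x) + 𝟙 (A x ∧ B x)) ≡⟨ solve 3 (λ s o a → s :+ (o :+ a) := s :+ a :+ o) refl (∑ f) _ (𝟙 (A x ∧ B x)) ⟩
    ∑ f + 𝟙 (A x ∧ B x) + 𝟙 (A x ∨ B x)   ≡⟨ cong₂ (λ d a → d + 𝟙 (A x ∧ B x) + 𝟙 a) (deg≡∑ G x) (trans (adj-sym G x v) (adj≡A∨B x)) ⟨
    deg G x + 𝟙 (A x ∧ B x) + f v         ∎)
    where
    open ≡-Reasoning
    open +-*-Solver
    f g : V → ℕ
    f y = 𝟙 (adj G x y)
    g y = 𝟙 (adj G′ (suc x) (suc y))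

  |A|+|B| : |A| + |B| ≡ deg G v + ∑ (λ y → 𝟙 (A y ∧ B y))
  |A|+|B| = begin
    |A| + |B|                                        ≡⟨ ∑-distrib-+ (𝟙 ∘ A) (𝟙 ∘ B) ⟨
    ∑ (λ y → 𝟙 (A y) + 𝟙 (B y))                      ≡⟨ sum-cong-≗ (λ y → trans (𝟙-∨-∧ (A y) (B y))
                                                                        (cong (λ a → 𝟙 a + _) (sym (adj≡A∨B y)))) ⟩
    ∑ (λ y → 𝟙 (adj G v y) + 𝟙 (A y ∧ B y))          ≡⟨ ∑-distrib-+ (𝟙 ∘ adj G v) _ ⟩
    ∑ (𝟙 ∘ adj G v) + ∑ (λ y → 𝟙 (A y ∧ B y))        ≡⟨ cong (_+ _) (deg≡∑ G v) ⟨
    deg G v + ∑ (λ y → 𝟙 (A y ∧ B y))                ∎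
    where open ≡-Reasoning

  ∑⌈deg/2⌉-split : ∑⌈deg/2⌉ G′ ≡ ⌈ |B| /2⌉ + ∑ (λ x → ⌈ deg G′ (suc x) /2⌉)
  ∑⌈deg/2⌉-split = cong (λ d → ⌈ d /2⌉ + ∑ (λ x → ⌈ deg G′ (suc x) /2⌉)) deg-v₂

  lift-adj : ∀ {a c} → a ≢ v → adj G a c ≡ true → ∃ λ c′ → π c′ ≡ c × adj G′ (suc a) c′ ≡ true
  lift-adj {a} {c} a≢v ac with c ≟ v
  ... | no c≢v = suc c , refl , trans (adj′-other a≢v c≢v) ac
  ... | yes refl with proj₂ (proj₂ valid) a (adj-flip G ac)
  ...   | inj₁ Aa = suc v , refl , trans (adj′-to-v₁ a≢v) Aa
  ...   | inj₂ Ba = zero , refl , Ba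

  -- A walk of G lifts to G′ until it first passes through v, where it reaches v₁ or v₂.
  lift-Connected : ∀ {a b} → Connected G a b → ∀ a′ → π a′ ≡ a →
    (∃ λ b′ → π b′ ≡ b × Connected G′ a′ b′) ⊎ (Connected G′ a′ (suc v) ⊎ Connected G′ a′ zero)
  lift-Connected here a′ πa′≡a = inj₁ (a′ , πa′≡a , here)
  lift-Connected (there ac c) zero refl = inj₂ (inj₂ here)
  lift-Connected (there ac c) (suc a) refl with a ≟ v
  ... | yes refl = inj₂ (inj₁ here)
  ... | no a≢v with lift-adj a≢v ac
  ...   | c′ , πc′ , a′c′ with lift-Connected c c′ πc′
  ...     | inj₁ (b′ , πb′ , c′b′) = inj₁ (b′ , πb′ , there a′c′ c′b′)
  ...     | inj₂ (inj₁ c′v₁)       = inj₂ (inj₁ (there a′c′ c′v₁))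
  ...     | inj₂ (inj₂ c′v₂)       = inj₂ (inj₂ (there a′c′ c′v₂))

  Connected-v⇒Connected-v₁⊎v₂ : ∀ x → Connected G (π x) v → Connected G′ x (suc v) ⊎ Connected G′ x zero
  Connected-v⇒Connected-v₁⊎v₂ x c with lift-Connected c x refl
  ... | inj₁ (zero  , _    , c′) = inj₂ c′
  ... | inj₁ (suc _ , refl , c′) = inj₁ c′
  ... | inj₂ c′                  = c′

  away-Connected : ∀ {x y} → ¬ Connected G x v → Connected G x y → Connected G′ (suc x) (suc y)
  away-Connected {x} ¬xv c with lift-Connected c (suc x) refl
  ... | inj₁ (zero  , refl , _)  = contradiction c ¬xv
  ... | inj₁ (suc _ , refl , c′) = c′
  ... | inj₂ (inj₁ c′)           = contradiction (π-Connected c′) ¬xv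
  ... | inj₂ (inj₂ c′)           = contradiction (π-Connected c′) ¬xv

  deg-away : ∀ {x} → ¬ Connected G x v → deg G′ (suc x) ≡ deg G x
  deg-away {x} ¬xv = trans (deg-other x≢v) (trans (cong (λ b → deg G x + 𝟙 b) A∧B≡false) (+-identityʳ _))
    where
    x≢v : x ≢ v
    x≢v refl = ¬xv here
    A∧B≡false : A x ∧ B x ≡ false
    A∧B≡false with A x in Ax
    ... | true  = contradiction (Connected-sym G (adj⇒Connected G (A⇒adj x Ax))) ¬xv
    ... | false = refl

  away-EvenComponent⇒′ : ∀ {x} → ¬ Connected G x v → EvenComponent G x → EvenComponent G′ (suc x)
  away-EvenComponent⇒′ ¬xv even zero    c′ = contradiction (π-Connected c′) ¬xv
  away-EvenComponent⇒′ ¬xv even (suc w) c′ odd =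
    even w (π-Connected c′) (subst Odd (deg-away (¬xv ∘ Connected-trans G (π-Connected c′))) odd)

  away-EvenComponent⇐′ : ∀ {x} → ¬ Connected G x v → EvenComponent G′ (suc x) → EvenComponent G x
  away-EvenComponent⇐′ ¬xv even w c odd =
    even (suc w) (away-Connected ¬xv c) (subst Odd (sym (deg-away (¬xv ∘ Connected-trans G c))) odd)

  module Representatives {r : ℕ} (N : NumEvenComponents G r) where

    private
      reps     = proj₁ N
      length≡r = proj₁ (proj₂ N)
      even     = proj₁ (proj₂ (proj₂ N))
      disc     = proj₁ (proj₂ (proj₂ (proj₂ N)))
      covered  = proj₂ (proj₂ (proj₂ (proj₂ N)))
      away? = λ ρ → ¬? (Connected? G ρ v)

    away : List V
    away = filter away? reps

    private
      away-disc′ : AllPairs (λ a b → ¬ Connected G′ a b) (map suc away)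
      away-disc′ = AllPairs.map⁺ (AllPairs.map (λ ¬ab c → ¬ab (π-Connected c)) (AllPairs.filter⁺ away? disc))

      away-even′ : ∀ x → x ∈ map suc away → EvenComponent G′ x
      away-even′ x x∈ with ∈-map⁻ suc x∈
      ... | ρ , ρ∈ , refl = let (ρ∈reps , ¬ρv) = ∈-filter⁻ away? {xs = reps} ρ∈ in
                            away-EvenComponent⇒′ ¬ρv (even ρ ρ∈reps)

      away⇒¬Connected-v : ∀ {ρ} → ρ ∈ away → ¬ Connected G ρ v
      away⇒¬Connected-v ρ∈ = proj₂ (∈-filter⁻ away? {xs = reps} ρ∈)

    away≤r′ : ∀ {r′} → NumEvenComponents G′ r′ → length away ≤ r′
    away≤r′ {r′} N′ = subst (_≤ r′) (length-map suc away) (≤numEvenComponents G′ N′ (map suc away) away-disc′ away-even′)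

    suc-away≤r′ : ∀ {r′} → EvenComponent G′ (suc v) → NumEvenComponents G′ r′ → suc (length away) ≤ r′
    suc-away≤r′ {r′} even-v₁ N′ = subst (_≤ r′) (cong suc (length-map suc away))
      (≤numEvenComponents G′ N′ (suc v ∷ map suc away) (All.tabulate v₁-disc ∷ away-disc′) even′)
      where
      v₁-disc : ∀ {y} → y ∈ map suc away → ¬ Connected G′ (suc v) y
      v₁-disc y∈ c with ∈-map⁻ suc y∈
      ... | ρ , ρ∈ , refl = away⇒¬Connected-v ρ∈ (Connected-sym G (π-Connected c))
      even′ : ∀ x → x ∈ suc v ∷ map suc away → EvenComponent G′ x
      even′ x (here refl) = even-v₁
      even′ x (there x∈) = away-even′ x x∈

    r′≤away : ∀ {r′} → NumEvenComponents G′ r′ → ¬ EvenComponent G′ zero → ¬ EvenComponent G′ (suc v) → r′ ≤ length away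
    r′≤away {r′} N′ ¬even-v₂ ¬even-v₁ = subst (r′ ≤_) (length-map suc away) (numEvenComponents≤ G′ N′ (map suc away) covered′)
      where
      covered′ : ∀ w → EvenComponent G′ w → ∃ λ m → m ∈ map suc away × Connected G′ w m
      covered′ w even-w with Connected? G (π w) v
      ... | yes wv with Connected-v⇒Connected-v₁⊎v₂ w wv
      ...   | inj₁ wv₁ = contradiction (EvenComponent-resp G′ wv₁ even-w) ¬even-v₁
      ...   | inj₂ wv₂ = contradiction (EvenComponent-resp G′ wv₂ even-w) ¬even-v₂
      covered′ zero    even-w | no ¬wv = contradiction here ¬wv
      covered′ (suc x) even-w | no ¬xv with covered x (away-EvenComponent⇐′ ¬xv even-w)
      ... | ρ , ρ∈reps , ρx = suc ρ , ∈-map⁺ suc (∈-filter⁺ away? ρ∈reps ¬ρv) , Connected-sym G′ (away-Connected ¬ρv ρx)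
        where
        ¬ρv : ¬ Connected G ρ v
        ¬ρv ρv = ¬xv (Connected-trans G (Connected-sym G ρx) ρv)

    away≤r : length away ≤ r
    away≤r = subst (length away ≤_) length≡r (length-filter away? reps)

    r≤suc-away : r ≤ suc (length away)
    r≤suc-away = subst (_≤ suc (length away)) length≡r (at-most-one-near-v disc)
      where
      at-most-one-near-v : ∀ {xs} → AllPairs (λ a b → ¬ Connected G a b) xs → length xs ≤ suc (length (filter away? xs))
      at-most-one-near-v {[]}     _ = z≤n
      at-most-one-near-v {x ∷ xs} (x-disc ∷ disc′) with Connected? G x v
      ... | no _   = s≤s (at-most-one-near-v disc′)
      ... | yes xv = s≤s (≤-reflexive (cong length (sym (filter-all away? (All.map (far-from-v xv) x-disc)))))
        where
        far-from-v : ∀ {y} → Connected G x v → ¬ Connected G x y → ¬ Connected G y v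
        far-from-v xv ¬xy yv = ¬xy (Connected-trans G xv (Connected-sym G yv))

    r≤away : ¬ EvenComponent G v → r ≤ length away
    r≤away ¬even-v = subst (_≤ length away) length≡r (≤-reflexive (cong length (sym (filter-all away? (All.tabulate ρ-away)))))
      where
      ρ-away : ∀ {ρ} → ρ ∈ reps → ¬ Connected G ρ v
      ρ-away {ρ} ρ∈ ρv = ¬even-v (EvenComponent-resp G ρv (even ρ ρ∈))

    suc-away≤r : EvenComponent G v → suc (length away) ≤ r
    suc-away≤r even-v with covered v even-v
    ... | ρ , ρ∈reps , ρv = subst (suc (length away) ≤_) length≡r (filter-notAll away? reps (Any.map (λ { refl ¬ρv → ¬ρv ρv }) ρ∈reps))

  |A|+|B|≡deg : (∀ x → A x ∧ B x ≡ false) → |A| + |B| ≡ deg G v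
  |A|+|B|≡deg disjoint = trans |A|+|B| (trans (cong (deg G v +_) (∑-zero (cong 𝟙 ∘ disjoint))) (+-identityʳ _))

cancel-middle : ∀ F a d H b → F + a ≤ H + d → d ≤ a + b → F ≤ b + H
cancel-middle F a d H b F+a≤H+d d≤a+b = +-cancelʳ-≤ a F (b + H) (begin
  F + a        ≤⟨ F+a≤H+d ⟩
  H + d        ≤⟨ +-monoʳ-≤ H d≤a+b ⟩
  H + (a + b)  ≡⟨ solve 3 (λ H a b → H :+ (a :+ b) := b :+ H :+ a) refl H a b ⟩
  b + H + a    ∎)
  where
  open ≤-Reasoning
  open +-*-Solver

module PotentialMonotone (G : Graph) (v : Fin (n G)) (A B : Fin (n G) → Bool) (valid : ValidSplit G v A B) where

  open Splitting G v A B valid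

  private
    f g : Fin (n G) → ℕ
    f x = ⌈ deg G x /2⌉
    g x = ⌈ deg G′ (suc x) /2⌉

    f≤g : ∀ x → x ≢ v → f x ≤ g x
    f≤g x x≢v = ⌈n/2⌉-mono (subst (deg G x ≤_) (sym (deg-other x≢v)) (m≤m+n _ _))

    g-v : g v ≡ ⌈ |A| /2⌉
    g-v = cong ⌈_/2⌉ deg-v₁

    ⌈d/2⌉≤⌈|A|/2⌉+⌈|B|/2⌉ : ⌈ deg G v /2⌉ ≤ ⌈ |A| /2⌉ + ⌈ |B| /2⌉
    ⌈d/2⌉≤⌈|A|/2⌉+⌈|B|/2⌉ = ≤-trans (⌈n/2⌉-mono (subst (deg G v ≤_) (sym |A|+|B|) (m≤m+n _ _))) (⌈/2⌉-+-≤ |A| |B|)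

    finish : ∀ F d → F + ⌈ |A| /2⌉ ≤ ∑ g + d → d ≤ ⌈ |A| /2⌉ + ⌈ |B| /2⌉ → F ≤ ∑⌈deg/2⌉ G′
    finish F d base split = subst (F ≤_) (sym ∑⌈deg/2⌉-split) (cancel-middle F _ d (∑ g) _ base split)

    base : ∑ f + ⌈ |A| /2⌉ ≤ ∑ g + ⌈ deg G v /2⌉
    base = subst (λ a → ∑ f + a ≤ ∑ g + f v) g-v (∑-except-≤ v f≤g)

  ∑⌈deg/2⌉-mono : ∑⌈deg/2⌉ G ≤ ∑⌈deg/2⌉ G′
  ∑⌈deg/2⌉-mono = finish (∑ f) _ base ⌈d/2⌉≤⌈|A|/2⌉+⌈|B|/2⌉

  ∑⌈deg/2⌉-<-overlap : ∀ {x} → EvenComponent G v → A x ∧ B x ≡ true → ∑⌈deg/2⌉ G < ∑⌈deg/2⌉ G′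
  ∑⌈deg/2⌉-<-overlap {x} even-v A∧B = finish (suc (∑ f)) _ strict-base ⌈d/2⌉≤⌈|A|/2⌉+⌈|B|/2⌉
    where
    Ax : A x ≡ true
    Ax = Bool.∧-conicalˡ (A x) (B x) A∧B
    x≢v : x ≢ v
    x≢v refl with trans (sym Ax) A-v
    ... | ()
    fx<gx : f x < g x
    fx<gx = ≤-reflexive (sym (begin
      g x                         ≡⟨ cong ⌈_/2⌉ (deg-other x≢v) ⟩
      ⌈ deg G x + 𝟙 (A x ∧ B x) /2⌉ ≡⟨ cong (λ b → ⌈ deg G x + 𝟙 b /2⌉) A∧B ⟩
      ⌈ deg G x + 1 /2⌉           ≡⟨ cong ⌈_/2⌉ (+-comm (deg G x) 1) ⟩
      ⌈ suc (deg G x) /2⌉         ≡⟨ ⌈suc/2⌉-even (deg G x) (¬Odd⇒parity≡0ℙ (even-v x (adj⇒Connected G (A⇒adj x Ax)))) ⟩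
      suc (f x)                   ∎))
      where open ≡-Reasoning
    strict-base : suc (∑ f + ⌈ |A| /2⌉) ≤ ∑ g + ⌈ deg G v /2⌉
    strict-base = subst (λ a → suc (∑ f + a) ≤ ∑ g + f v) g-v (∑-except-< v x x≢v f≤g fx<gx)

  ∑⌈deg/2⌉-<-odd-parts : Odd |A| → Odd |B| → (∀ x → A x ∧ B x ≡ false) → ∑⌈deg/2⌉ G < ∑⌈deg/2⌉ G′
  ∑⌈deg/2⌉-<-odd-parts odd-A odd-B disjoint =
    finish (suc (∑ f)) (suc ⌈ deg G v /2⌉) (subst (suc (∑ f + ⌈ |A| /2⌉) ≤_) (sym (+-suc _ _)) (s≤s base)) split
    where
    split : suc ⌈ deg G v /2⌉ ≤ ⌈ |A| /2⌉ + ⌈ |B| /2⌉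
    split = ≤-reflexive (trans (cong (λ d → suc ⌈ d /2⌉) (sym (|A|+|B|≡deg disjoint))) (⌈/2⌉-+-odd odd-A odd-B))

  private
    strict⇒mono : ∀ {r r′} → NumEvenComponents G r → NumEvenComponents G′ r′ →
      ∑⌈deg/2⌉ G < ∑⌈deg/2⌉ G′ → ∑⌈deg/2⌉ G + r ≤ ∑⌈deg/2⌉ G′ + r′
    strict⇒mono {r} {r′} N N′ S<S′ = begin
      ∑⌈deg/2⌉ G + r                  ≤⟨ +-monoʳ-≤ (∑⌈deg/2⌉ G) r≤suc-away ⟩
      ∑⌈deg/2⌉ G + suc (length away)  ≡⟨ +-suc (∑⌈deg/2⌉ G) (length away) ⟩
      suc (∑⌈deg/2⌉ G) + length away  ≤⟨ +-mono-≤ S<S′ (away≤r′ N′) ⟩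
      ∑⌈deg/2⌉ G′ + r′                ∎
      where
      open Representatives N
      open ≤-Reasoning

    even-v₁ : EvenComponent G v → (∀ x → A x ∧ B x ≡ false) → ¬ Odd |A| → ¬ Odd |B| → EvenComponent G′ (suc v)
    even-v₁ even-v disjoint ¬odd-A ¬odd-B zero    _ = ¬odd-B ∘ subst Odd deg-v₂
    even-v₁ even-v disjoint ¬odd-A ¬odd-B (suc x) c with x ≟ v
    ... | yes refl = ¬odd-A ∘ subst Odd deg-v₁
    ... | no x≢v   = even-v x (π-Connected c) ∘ subst Odd deg-x
      where
      deg-x : deg G′ (suc x) ≡ deg G x
      deg-x = trans (deg-other x≢v) (trans (cong (λ b → deg G x + 𝟙 b) (disjoint x)) (+-identityʳ _))

    parity-|A|≡parity-|B| : EvenComponent G v → (∀ x → A x ∧ B x ≡ false) → parity |A| ≡ parity |B|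
    parity-|A|≡parity-|B| even-v disjoint =
      parity-+≡0ℙ |A| |B| (trans (cong parity (|A|+|B|≡deg disjoint)) (¬Odd⇒parity≡0ℙ (even-v v here)))

    partition-mono : ∀ {r r′} → NumEvenComponents G r → NumEvenComponents G′ r′ →
      EvenComponent G v → (∀ x → A x ∧ B x ≡ false) → ∑⌈deg/2⌉ G + r ≤ ∑⌈deg/2⌉ G′ + r′
    partition-mono N N′ even-v disjoint with odd? |A|
    ... | yes odd-A = strict⇒mono N N′ (∑⌈deg/2⌉-<-odd-parts odd-A odd-B disjoint)
      where
      odd-B : Odd |B|
      odd-B = parity≡1ℙ⇒Odd |B| (trans (sym (parity-|A|≡parity-|B| even-v disjoint)) (Odd⇒parity≡1ℙ odd-A))
    ... | no ¬odd-A = +-mono-≤ ∑⌈deg/2⌉-mono (≤-trans r≤suc-away (suc-away≤r′ (even-v₁ even-v disjoint ¬odd-A ¬odd-B) N′))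
      where
      open Representatives N
      ¬odd-B : ¬ Odd |B|
      ¬odd-B = parity≡0ℙ⇒¬Odd (trans (sym (parity-|A|≡parity-|B| even-v disjoint)) (¬Odd⇒parity≡0ℙ ¬odd-A))

  potential-mono : ∀ {r r′} → NumEvenComponents G r → NumEvenComponents G′ r′ →
    ∑⌈deg/2⌉ G + r ≤ ∑⌈deg/2⌉ G′ + r′
  potential-mono N N′ with EvenComponent? G v
  ... | no ¬even-v = +-mono-≤ ∑⌈deg/2⌉-mono (≤-trans (r≤away ¬even-v) (away≤r′ N′))
    where open Representatives N
  ... | yes even-v with any? (λ x → (A x ∧ B x) Bool.≟ true)
  ...   | yes (x , A∧B) = strict⇒mono N N′ (∑⌈deg/2⌉-<-overlap even-v A∧B)
  ...   | no ¬overlap   = partition-mono N N′ even-v (λ x → Bool.¬-not (¬overlap ∘ (x ,_)))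

∑⌈deg/2⌉+r≤n+k : ∀ {G k H} → SplitSeq G k H →
  (∀ {r} → NumEvenComponents H r → ∑⌈deg/2⌉ H + r ≤ n H) →
  ∀ {r} → NumEvenComponents G r → ∑⌈deg/2⌉ G + r ≤ n G + k
∑⌈deg/2⌉+r≤n+k {G} done H-bound N = subst (∑⌈deg/2⌉ G + _ ≤_) (sym (+-identityʳ (n G))) (H-bound N)
∑⌈deg/2⌉+r≤n+k {G} {suc k} (step v A B valid splits) H-bound {r} N
  with numEvenComponents (splitGraph G v A B)
... | r′ , N′ = begin
  ∑⌈deg/2⌉ G + r                       ≤⟨ PotentialMonotone.potential-mono G v A B valid N N′ ⟩
  ∑⌈deg/2⌉ (splitGraph G v A B) + r′   ≤⟨ ∑⌈deg/2⌉+r≤n+k splits H-bound N′ ⟩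
  suc (n G) + k                        ≡⟨ +-suc (n G) k ⟨
  n G + suc k                          ∎
  where open ≤-Reasoning

-- Unions of paths

module _ {A : Set} where

  Unique-resp-↭ : ∀ {xs ys : List A} → xs ↭ ys → Unique xs → Unique ys
  Unique-resp-↭ xs↭ys = Permutationₛ.Unique-resp-↭ (setoid A) (↭⇒↭ₛ xs↭ys)

  Unique-++⁻ : ∀ (xs : List A) {ys} → Unique (xs ++ ys) → Unique xs × Unique ys × (∀ {z} → z ∈ xs → z ∈ ys → ⊥)
  Unique-++⁻ []       unique           = [] , unique , λ ()
  Unique-++⁻ (x ∷ xs) (x∉ ∷ unique) with Unique-++⁻ xs unique
  ... | unique-xs , unique-ys , disjoint = All.++⁻ˡ xs x∉ ∷ unique-xs , unique-ys , disjoint′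
    where
    disjoint′ : ∀ {z} → z ∈ x ∷ xs → z ∈ _ → ⊥
    disjoint′ (here refl) z∈ys = All.lookup (All.++⁻ʳ xs x∉) z∈ys refl
    disjoint′ (there z∈xs) z∈ys = disjoint z∈xs z∈ys

  unique-split : ∀ (P P′ : List A) {x Q Q′} → Unique (P ++ x ∷ Q) → P ++ x ∷ Q ≡ P′ ++ x ∷ Q′ → P ≡ P′ × Q ≡ Q′
  unique-split [] [] _ eq = refl , proj₂ (∷-injective eq)
  unique-split [] (p ∷ P′) {x} (x∉ ∷ _) eq with ∷-injective eq
  ... | refl , eq′ = contradiction refl (All.lookup x∉ (subst (x ∈_) (sym eq′) (∈-++⁺ʳ P′ (here refl))))
  unique-split (p ∷ P) [] (p∉ ∷ _) eq with ∷-injective eq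
  ... | refl , _ = contradiction refl (All.lookup p∉ (∈-++⁺ʳ P (here refl)))
  unique-split (p ∷ P) (p′ ∷ P′) (_ ∷ unique) eq with ∷-injective eq
  ... | refl , eq′ with unique-split P P′ unique eq′
  ...   | refl , Q≡Q′ = refl , Q≡Q′

  lastAsList : List A → List A
  lastAsList []           = []
  lastAsList (a ∷ [])     = a ∷ []
  lastAsList (a ∷ b ∷ as) = lastAsList (b ∷ as)

  lastAsList-snoc : ∀ (xs : List A) y → lastAsList (xs ++ y ∷ []) ≡ y ∷ []
  lastAsList-snoc []           y = refl
  lastAsList-snoc (a ∷ [])     y = refl
  lastAsList-snoc (a ∷ b ∷ as) y = lastAsList-snoc (b ∷ as) y

  length-lastAsList : ∀ (xs : List A) → length (lastAsList xs) ≤ 1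
  length-lastAsList []           = z≤n
  length-lastAsList (a ∷ [])     = s≤s z≤n
  length-lastAsList (a ∷ b ∷ as) = length-lastAsList (b ∷ as)

  headAsList : List A → List A
  headAsList []      = []
  headAsList (y ∷ _) = y ∷ []

  length-headAsList : ∀ (xs : List A) → length (headAsList xs) ≤ 1
  length-headAsList []      = z≤n
  length-headAsList (_ ∷ _) = s≤s z≤n

module _ {k : ℕ} where

  private
    L = List (Fin k)

  Consecutive⇒∈ : ∀ {p : L} {x y} → Consecutive p x y → x ∈ p × y ∈ p
  Consecutive⇒∈ (xs , ys , refl) = ∈-++⁺ʳ xs (here refl) , ∈-++⁺ʳ xs (there (here refl))

  Consecutive⇒next : ∀ {p : L} {xs x ys y} → Unique p → p ≡ xs ++ x ∷ ys → Consecutive p x y →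
    y ∈ lastAsList xs ++ headAsList ys
  Consecutive⇒next {xs = xs} unique refl (xs′ , ys′ , eq) with unique-split xs xs′ unique eq
  ... | refl , refl = ∈-++⁺ʳ (lastAsList xs) (here refl)

  Consecutive⇒prev : ∀ {p : L} {xs x ys y} → Unique p → p ≡ xs ++ x ∷ ys → Consecutive p y x →
    y ∈ lastAsList xs ++ headAsList ys
  Consecutive⇒prev {xs = xs} {x} {y = y} unique refl (xs′ , ys′ , eq)
    with unique-split xs (xs′ ++ y ∷ []) unique (trans eq (sym (++-assoc xs′ (y ∷ []) (x ∷ ys′))))
  ... | refl , refl = ∈-++⁺ˡ (subst (y ∈_) (sym (lastAsList-snoc xs′ y)) (here refl))

  same-path : ∀ (ps : List L) {p p′ x} → Unique (concat ps) → p ∈ ps → p′ ∈ ps → x ∈ p → x ∈ p′ → p ≡ p′ × Unique p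
  same-path (q ∷ qs) unique (here refl) (here refl) _ _ = refl , proj₁ (Unique-++⁻ q unique)
  same-path (q ∷ qs) unique (here refl) (there p′∈) x∈q x∈p′ =
    contradiction (∈-concat⁺′ x∈p′ p′∈) (proj₂ (proj₂ (Unique-++⁻ q unique)) x∈q)
  same-path (q ∷ qs) unique (there p∈) (here refl) x∈p x∈q =
    contradiction (∈-concat⁺′ x∈p p∈) (proj₂ (proj₂ (Unique-++⁻ q unique)) x∈q)
  same-path (q ∷ qs) unique (there p∈) (there p′∈) x∈p x∈p′ =
    same-path qs (proj₁ (proj₂ (Unique-++⁻ q unique))) p∈ p′∈ x∈p x∈p′

  Consecutive⇒two-element-prefix : ∀ {p : L} {x y} → Consecutive p x y → ∃₂ λ h b → ∃ λ t → p ≡ h ∷ b ∷ t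
  Consecutive⇒two-element-prefix {x = x} {y} ([]           , ys , refl) = x , y , ys , refl
  Consecutive⇒two-element-prefix {x = x} {y} (a ∷ []       , ys , refl) = a , x , y ∷ ys , refl
  Consecutive⇒two-element-prefix {x = x} {y} (a ∷ a′ ∷ as , ys , refl) = a , a′ , as ++ x ∷ y ∷ ys , refl

  ¬Consecutive-singleton : ∀ {z x y : Fin k} → ¬ Consecutive (z ∷ []) x y
  ¬Consecutive-singleton ([]             , _ , ())
  ¬Consecutive-singleton ((_ ∷ [])       , _ , ())
  ¬Consecutive-singleton ((_ ∷ _ ∷ _)    , _ , ())

  Consecutive-∷ : ∀ {a : Fin k} {q x y} → Consecutive q x y → Consecutive (a ∷ q) x y
  Consecutive-∷ {a = a} (xs , ys , eq) = a ∷ xs , ys , cong (a ∷_) eq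

  Consecutive-∷ʳ : ∀ {a : Fin k} {q x y} → Consecutive q x y → Consecutive (q ++ a ∷ []) x y
  Consecutive-∷ʳ {a = a} {x = x} {y} (xs , ys , eq) =
    xs , ys ++ a ∷ [] , trans (cong (_++ a ∷ []) eq) (++-assoc xs (x ∷ y ∷ ys) (a ∷ []))

  Consecutive-∷⁻ : ∀ {a : Fin k} {q x y} → Consecutive (a ∷ q) x y → (x ≡ a × ∃ λ t → q ≡ y ∷ t) ⊎ Consecutive q x y
  Consecutive-∷⁻ ([] , ys , eq) with ∷-injective eq
  ... | refl , q≡ = inj₁ (refl , ys , q≡)
  Consecutive-∷⁻ ((_ ∷ xs) , ys , eq) = inj₂ (xs , ys , proj₂ (∷-injective eq))

  Consecutive-∷ʳ⁻ : ∀ {a : Fin k} {q x y} → Consecutive (q ++ a ∷ []) x y → (y ≡ a × ∃ λ s → q ≡ s ++ x ∷ []) ⊎ Consecutive q x y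
  Consecutive-∷ʳ⁻ {a = a} {q} {x} {y} (xs , ys , eq) with initLast ys
  ... | [] with ∷ʳ-injective q (xs ++ x ∷ []) (trans eq (sym (++-assoc xs (x ∷ []) (y ∷ []))))
  ...   | q≡ , refl = inj₁ (refl , xs , q≡)
  Consecutive-∷ʳ⁻ {a = a} {q} {x} {y} (xs , ys , eq) | ys′ ∷ʳ′ c
    with ∷ʳ-injective q (xs ++ x ∷ y ∷ ys′) (trans eq (sym (++-assoc xs (x ∷ y ∷ ys′) (c ∷ []))))
  ... | q≡ , _ = inj₂ (xs , ys′ , q≡)

concat⁺-↭ : ∀ {A : Set} {xss yss : List (List A)} → xss ↭ yss → concat xss ↭ concat yss
concat⁺-↭ ↭.refl           = ↭.refl
concat⁺-↭ (↭.prep xs p)    = ++⁺ˡ xs (concat⁺-↭ p)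
concat⁺-↭ (↭.swap xs ys p) = ↭.trans (shifts xs ys) (++⁺ˡ ys (++⁺ˡ xs (concat⁺-↭ p)))
concat⁺-↭ (↭.trans p q)    = ↭.trans (concat⁺-↭ p) (concat⁺-↭ q)

⌈d/2⌉+[d≡0]≤1 : ∀ d → d ≤ 2 → ⌈ d /2⌉ + 𝟙 (does (d ℕ.≟ 0)) ≤ 1
⌈d/2⌉+[d≡0]≤1 zero                _ = s≤s z≤n
⌈d/2⌉+[d≡0]≤1 (suc zero)          _ = s≤s z≤n
⌈d/2⌉+[d≡0]≤1 (suc (suc zero))    _ = s≤s z≤n
⌈d/2⌉+[d≡0]≤1 (suc (suc (suc d))) (s≤s (s≤s ()))

module PathUnion (H : Graph) (P : IsDisjointUnionOfPaths H) where

  private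
    V = Fin (n H)

  paths : List (List V)
  paths = proj₁ P

  private
    covers = proj₁ (proj₂ P)
    adj⇔consecutive = proj₂ (proj₂ P)

  consecutive⇒adj : ∀ {p x y} → p ∈ paths → Consecutive p x y → adj H x y ≡ true
  consecutive⇒adj p∈ c = proj₂ (adj⇔consecutive _ _) (_ , p∈ , inj₁ c)

  unique-vertices : Unique (concat paths)
  unique-vertices = Unique-resp-↭ (↭-sym covers) (Unique.allFin⁺ (n H))

  path-of : ∀ x → ∃ λ p → p ∈ paths × x ∈ p
  path-of x with ∈-concat⁻′ paths (∈-resp-↭ (↭-sym covers) (∈-allFin x))
  ... | p , x∈p , p∈ = p , p∈ , x∈p

  private
    ∈-middle : ∀ {p xs ys} {x : V} → p ≡ xs ++ x ∷ ys → x ∈ p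
    ∈-middle {xs = xs} refl = ∈-++⁺ʳ xs (here refl)

  neighbours-at-ends : ∀ {p x xs ys} → p ∈ paths → p ≡ xs ++ x ∷ ys → ∀ y → adj H x y ≡ true →
    y ∈ lastAsList xs ++ headAsList ys
  neighbours-at-ends p∈ p≡ y xy with proj₁ (adj⇔consecutive _ y) xy
  ... | p′ , p′∈ , inj₁ c with same-path paths unique-vertices p∈ p′∈ (∈-middle p≡) (proj₁ (Consecutive⇒∈ c))
  ...   | refl , unique = Consecutive⇒next unique p≡ c
  neighbours-at-ends p∈ p≡ y xy | p′ , p′∈ , inj₂ c with same-path paths unique-vertices p∈ p′∈ (∈-middle p≡) (proj₂ (Consecutive⇒∈ c))
  ...   | refl , unique = Consecutive⇒prev unique p≡ c

  deg≤ends : ∀ {p x xs ys} → p ∈ paths → p ≡ xs ++ x ∷ ys → deg H x ≤ length (lastAsList xs ++ headAsList ys)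
  deg≤ends p∈ p≡ = deg≤length H _ _ (neighbours-at-ends p∈ p≡)

  deg≤2 : ∀ x → deg H x ≤ 2
  deg≤2 x with path-of x
  ... | p , p∈ , x∈p with ∈-∃++ x∈p
  ...   | xs , ys , p≡ = ≤-trans (deg≤ends p∈ p≡)
          (subst (_≤ 2) (sym (length-++ (lastAsList xs))) (+-mono-≤ (length-lastAsList xs) (length-headAsList ys)))

  Connected-along : ∀ {p} → p ∈ paths → ∀ pre {h t x} → p ≡ pre ++ h ∷ t → x ∈ h ∷ t → Connected H h x
  Connected-along p∈ pre p≡ (here refl) = here
  Connected-along p∈ pre {h} {b ∷ t} p≡ (there x∈t) =
    there (consecutive⇒adj p∈ (pre , t , p≡))
          (Connected-along p∈ (pre ++ h ∷ []) (trans p≡ (sym (++-assoc pre (h ∷ []) (b ∷ t)))) x∈t)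

  private
    on-path : ∀ {p : List V} {x y} → Consecutive p x y ⊎ Consecutive p y x → x ∈ p × ∃₂ λ h b → ∃ λ t → p ≡ h ∷ b ∷ t
    on-path (inj₁ c) = proj₁ (Consecutive⇒∈ c) , Consecutive⇒two-element-prefix c
    on-path (inj₂ c) = proj₂ (Consecutive⇒∈ c) , Consecutive⇒two-element-prefix c

  -- The first vertex of the path through an edge at x is an endpoint of degree 1.
  Connected-to-odd : ∀ x → 1 ≤ deg H x → ∃ λ h → Connected H x h × Odd (deg H h)
  Connected-to-odd x 1≤d with 1≤deg⇒adj H x 1≤d
  ... | y , xy with proj₁ (adj⇔consecutive x y) xy
  ...   | p , p∈ , c with on-path c
  ...     | x∈p , h , b , t , refl = h , Connected-sym H (Connected-along p∈ [] refl x∈p) , subst Odd (sym deg-h≡1) one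
    where
    deg-h≡1 : deg H h ≡ 1
    deg-h≡1 = ≤-antisym (deg≤ends {xs = []} p∈ refl) (adj⇒1≤deg H (consecutive⇒adj p∈ ([] , t , refl)))

  ∑⌈deg/2⌉+r≤n : ∀ {r} → NumEvenComponents H r → ∑⌈deg/2⌉ H + r ≤ n H
  ∑⌈deg/2⌉+r≤n {r} N = begin
    ∑⌈deg/2⌉ H + r                                          ≤⟨ +-monoʳ-≤ (∑⌈deg/2⌉ H) (numEvenComponents≤ H N (isolated H) covered) ⟩
    ∑⌈deg/2⌉ H + length (isolated H)                        ≡⟨ cong (∑⌈deg/2⌉ H +_) (length-isolated H) ⟩
    ∑⌈deg/2⌉ H + ∑ (λ x → 𝟙 (does (deg H x ℕ.≟ 0)))         ≡⟨ ∑-distrib-+ (λ x → ⌈ deg H x /2⌉) _ ⟨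
    ∑ (λ x → ⌈ deg H x /2⌉ + 𝟙 (does (deg H x ℕ.≟ 0)))      ≤⟨ ∑-mono-≤ (λ x → ⌈d/2⌉+[d≡0]≤1 (deg H x) (deg≤2 x)) ⟩
    ∑ {n H} (λ _ → 1)                                       ≡⟨ ∑-const-1 (n H) ⟩
    n H                                                     ∎
    where
    open ≤-Reasoning
    covered : ∀ w → EvenComponent H w → ∃ λ m → m ∈ isolated H × Connected H w m
    covered w even-w with deg H w ℕ.≟ 0
    ... | yes d≡0 = w , ∈-filter⁺ (λ v → deg H v ℕ.≟ 0) (∈-allFin w) d≡0 , here
    ... | no d≢0 with Connected-to-odd w (n≢0⇒n>0 d≢0)
    ...   | h , wh , odd = contradiction odd (even-w h wh)

-- Graphs of maximum degree two

module EdgeDeletion (G : Graph) (u w : Fin (n G)) where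

  private
    V = Fin (n G)

  IsUW : V → V → Set
  IsUW x y = (x ≡ u × y ≡ w) ⊎ (x ≡ w × y ≡ u)

  isUW? : ∀ x y → Dec (IsUW x y)
  isUW? x y = (x ≟ u ×-dec y ≟ w) ⊎-dec (x ≟ w ×-dec y ≟ u)

  private
    IsUW-sym : ∀ {x y} → IsUW x y → IsUW y x
    IsUW-sym (inj₁ (x≡u , y≡w)) = inj₂ (y≡w , x≡u)
    IsUW-sym (inj₂ (x≡w , y≡u)) = inj₁ (y≡u , x≡w)

    isUW?-sym : ∀ x y → does (isUW? x y) ≡ does (isUW? y x)
    isUW?-sym x y = does-⇔ (mk⇔ IsUW-sym IsUW-sym) (isUW? x y) (isUW? y x)

  G∖uw : Graph
  G∖uw = record
    { n          = n G
    ; adj        = λ x y → adj G x y ∧ not (does (isUW? x y))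
    ; adj-sym    = λ x y → cong₂ (λ a b → a ∧ not b) (adj-sym G x y) (isUW?-sym x y)
    ; adj-irrefl = λ x → cong (_∧ not (does (isUW? x x))) (adj-irrefl G x)
    }

  adj∖⇒adj : ∀ {x y} → adj G∖uw x y ≡ true → adj G x y ≡ true
  adj∖⇒adj {x} {y} = Bool.∧-conicalˡ (adj G x y) _

  adj⇒adj∖ : ∀ {x y} → adj G x y ≡ true → ¬ IsUW x y → adj G∖uw x y ≡ true
  adj⇒adj∖ {x} {y} xy ¬uw rewrite xy | dec-false (isUW? x y) ¬uw = refl

  private
    𝟙-adj∖ : ∀ {x y} → ¬ IsUW x y → 𝟙 (adj G∖uw x y) ≡ 𝟙 (adj G x y)
    𝟙-adj∖ {x} {y} ¬uw rewrite dec-false (isUW? x y) ¬uw = cong 𝟙 (Bool.∧-identityʳ (adj G x y))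

  deg∖-other : ∀ {x} → x ≢ u → x ≢ w → deg G∖uw x ≡ deg G x
  deg∖-other {x} x≢u x≢w = trans (deg≡∑ G∖uw x) (trans (sum-cong-≗ (λ y → 𝟙-adj∖ {x} {y} not-uw)) (sym (deg≡∑ G x)))
    where
    not-uw : ∀ {y} → ¬ IsUW x y
    not-uw (inj₁ (x≡u , _)) = x≢u x≡u
    not-uw (inj₂ (x≡w , _)) = x≢w x≡w

  suc-deg∖ : ∀ x o → IsUW x o → adj G x o ≡ true → (∀ y → y ≢ o → ¬ IsUW x y) → suc (deg G∖uw x) ≡ deg G x
  suc-deg∖ x o uw-xo xo only-o = begin
    suc (deg G∖uw x)           ≡⟨ cong suc (deg≡∑ G∖uw x) ⟩
    suc (∑ g)                  ≡⟨ +-comm 1 (∑ g) ⟩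
    ∑ g + 1                    ≡⟨ cong (λ b → ∑ g + 𝟙 b) xo ⟨
    ∑ g + f o                  ≡⟨ ∑-except-≡ o (λ y y≢o → 𝟙-adj∖ (only-o y y≢o)) ⟩
    ∑ f + g o                  ≡⟨ cong (λ b → ∑ f + 𝟙 (adj G x o ∧ not b)) (dec-true (isUW? x o) uw-xo) ⟩
    ∑ f + 𝟙 (adj G x o ∧ false) ≡⟨ cong (λ b → ∑ f + 𝟙 b) (Bool.∧-zeroʳ (adj G x o)) ⟩
    ∑ f + 0                    ≡⟨ +-identityʳ (∑ f) ⟩
    ∑ f                        ≡⟨ deg≡∑ G x ⟨
    deg G x                    ∎
    where
    open ≡-Reasoning
    f g : V → ℕ
    f y = 𝟙 (adj G x y)
    g y = 𝟙 (adj G∖uw x y)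

  module _ (u≢w : u ≢ w) (uw : adj G u w ≡ true) where

    suc-deg∖-u : suc (deg G∖uw u) ≡ deg G u
    suc-deg∖-u = suc-deg∖ u w (inj₁ (refl , refl)) uw only-w
      where
      only-w : ∀ y → y ≢ w → ¬ IsUW u y
      only-w y y≢w (inj₁ (_ , y≡w)) = y≢w y≡w
      only-w y y≢w (inj₂ (u≡w , _)) = u≢w u≡w

    suc-deg∖-w : suc (deg G∖uw w) ≡ deg G w
    suc-deg∖-w = suc-deg∖ w u (inj₂ (refl , refl)) (adj-flip G uw) only-u
      where
      only-u : ∀ y → y ≢ u → ¬ IsUW w y
      only-u y y≢u (inj₁ (w≡u , _)) = u≢w (sym w≡u)
      only-u y y≢u (inj₂ (_ , y≡u)) = y≢u y≡u

    deg∖≤deg : ∀ x → deg G∖uw x ≤ deg G x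
    deg∖≤deg x = by-cases (x ≟ u) (x ≟ w)
      where
      by-cases : Dec (x ≡ u) → Dec (x ≡ w) → deg G∖uw x ≤ deg G x
      by-cases (yes refl) _          = subst (deg G∖uw u ≤_) suc-deg∖-u (n≤1+n _)
      by-cases (no _)     (yes refl) = subst (deg G∖uw w ≤_) suc-deg∖-w (n≤1+n _)
      by-cases (no x≢u)   (no x≢w)   = ≤-reflexive (deg∖-other x≢u x≢w)

    deg∖-u≡0 : deg G u ≡ 1 → deg G∖uw u ≡ 0
    deg∖-u≡0 deg-u≡1 = suc-injective (trans suc-deg∖-u deg-u≡1)

    deg∖-w≤1 : deg G w ≤ 2 → deg G∖uw w ≤ 1
    deg∖-w≤1 deg-w≤2 = ≤-pred (subst (_≤ 2) (sym suc-deg∖-w) deg-w≤2)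

    ∑deg∖<∑deg : ∑ (deg G∖uw) < ∑ (deg G)
    ∑deg∖<∑deg = ∑-< u deg∖≤deg (≤-reflexive suc-deg∖-u)

-- A union of paths of G ∖ uw, where u has become isolated and w is an end of its path,
-- extends to one of G by appending u to that end.
module Reattach (G : Graph) (u w : Fin (n G)) (u≢w : u ≢ w) (uw : adj G u w ≡ true)
                (deg-u≡1 : deg G u ≡ 1) (deg-w≤2 : deg G w ≤ 2)
                (P₁ : IsDisjointUnionOfPaths (EdgeDeletion.G∖uw G u w)) where

  open EdgeDeletion G u w
  open PathUnion G∖uw P₁ using (paths; consecutive⇒adj; unique-vertices; path-of)

  private
    V = Fin (n G)
    covers = proj₁ (proj₂ P₁)
    adj∖⇔consecutive = proj₂ (proj₂ P₁)

  ¬adj∖-u : ∀ y → ¬ adj G∖uw u y ≡ true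
  ¬adj∖-u y uy = contradiction (subst (1 ≤_) (deg∖-u≡0 u≢w uw deg-u≡1) (adj⇒1≤deg G∖uw uy)) λ ()

  [u]∈paths : (u ∷ []) ∈ paths
  [u]∈paths with path-of u
  ... | p , p∈ , u∈p with ∈-∃++ u∈p
  ...   | xs , b ∷ ys , p≡ = contradiction (consecutive⇒adj p∈ (xs , ys , p≡)) (¬adj∖-u b)
  ...   | xs , [] , p≡ with initLast xs
  ...     | []        = subst (_∈ paths) p≡ p∈
  ...     | xs′ ∷ʳ′ a =
    contradiction (adj-flip G∖uw (consecutive⇒adj p∈ (xs′ , [] , trans p≡ (++-assoc xs′ (a ∷ []) (u ∷ []))))) (¬adj∖-u a)

  record EndOfPath : Set where
    field
      q      : List V
      q∈     : q ∈ paths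
      xs ys  : List V
      q≡     : q ≡ xs ++ w ∷ ys
      at-end : xs ≡ [] ⊎ ys ≡ []

  w-at-end : EndOfPath
  w-at-end with path-of w
  ... | p , p∈ , w∈p with ∈-∃++ w∈p
  ...   | xs , ys , p≡ with initLast xs
  ...     | [] = record { q = p ; q∈ = p∈ ; xs = [] ; ys = ys ; q≡ = p≡ ; at-end = inj₁ refl }
  ...     | xs′ ∷ʳ′ a with ys
  ...       | [] = record { q = p ; q∈ = p∈ ; xs = xs′ ∷ʳ a ; ys = [] ; q≡ = p≡ ; at-end = inj₂ refl }
  ...       | b ∷ ys′ = contradiction (2≤deg G∖uw wa wb a≢b) (λ 2≤d → 1+n≰n (≤-trans 2≤d (deg∖-w≤1 u≢w uw deg-w≤2)))
    where
    p≡′ : p ≡ xs′ ++ a ∷ w ∷ b ∷ ys′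
    p≡′ = trans p≡ (++-assoc xs′ (a ∷ []) (w ∷ b ∷ ys′))
    wa : adj G∖uw w a ≡ true
    wa = adj-flip G∖uw (consecutive⇒adj p∈ (xs′ , b ∷ ys′ , p≡′))
    wb : adj G∖uw w b ≡ true
    wb = consecutive⇒adj p∈ (xs′ ∷ʳ a , ys′ , p≡)
    a≢b : a ≢ b
    a≢b refl with proj₁ (proj₂ (Unique-++⁻ xs′ (subst Unique p≡′ (proj₂ (same-path paths unique-vertices p∈ p∈ w∈p w∈p)))))
    ... | a∉ ∷ _ = All.lookup a∉ (there (here refl)) refl

  open EndOfPath w-at-end

  record Decomposition : Set where
    field
      rest : List (List V)
      σ    : paths ↭ (u ∷ []) ∷ q ∷ rest

  private
    ↭-to-front : ∀ {p : List V} {ps} → p ∈ ps → ∃ λ others → ps ↭ p ∷ others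
    ↭-to-front {p} p∈ with ∈-∃++ p∈
    ... | A , B , ps≡ = A ++ B , subst (_↭ p ∷ (A ++ B)) (sym ps≡) (shift p A B)

  decomposition : Decomposition
  decomposition with ↭-to-front [u]∈paths
  ... | others , σ₁ with ∈-resp-↭ σ₁ q∈
  ...   | here q≡[u] = contradiction (w∈[u] (subst (w ∈_) q≡[u] (subst (w ∈_) (sym q≡) (∈-++⁺ʳ xs (here refl))))) (u≢w ∘ sym)
    where
    w∈[u] : w ∈ u ∷ [] → w ≡ u
    w∈[u] (here w≡u) = w≡u
  ...   | there q∈others with ↭-to-front q∈others
  ...     | rest , σ₂ = record { rest = rest ; σ = ↭.trans σ₁ (↭.prep (u ∷ []) σ₂) }

  open Decomposition decomposition

  record Extension : Set where
    field
      q′          : List V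
      q′-covers   : q′ ++ concat rest ↭ u ∷ (q ++ concat rest)
      uw-on-q′    : Consecutive q′ u w ⊎ Consecutive q′ w u
      q⇒q′        : ∀ {x y} → Consecutive q x y → Consecutive q′ x y
      q′⇒uw⊎q     : ∀ {x y} → Consecutive q′ x y → IsUW x y ⊎ Consecutive q x y

  extension : Extension
  extension with at-end
  ... | inj₁ xs≡[] = record
    { q′ = u ∷ q ; q′-covers = ↭.refl ; uw-on-q′ = inj₁ ([] , ys , cong (u ∷_) q≡w∷ys)
    ; q⇒q′ = Consecutive-∷ ; q′⇒uw⊎q = from-front }
    where
    q≡w∷ys : q ≡ w ∷ ys
    q≡w∷ys = trans q≡ (cong (_++ w ∷ ys) xs≡[])
    from-front : ∀ {x y} → Consecutive (u ∷ q) x y → IsUW x y ⊎ Consecutive q x y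
    from-front c with Consecutive-∷⁻ c
    ... | inj₁ (refl , t , q≡y∷t) = inj₁ (inj₁ (refl , sym (proj₁ (∷-injective (trans (sym q≡w∷ys) q≡y∷t)))))
    ... | inj₂ c′ = inj₂ c′
  ... | inj₂ ys≡[] = record
    { q′ = q ++ u ∷ [] ; q′-covers = covers′
    ; uw-on-q′ = inj₂ (xs , [] , trans (cong (_++ u ∷ []) q≡xs∷ʳw) (++-assoc xs (w ∷ []) (u ∷ [])))
    ; q⇒q′ = Consecutive-∷ʳ ; q′⇒uw⊎q = from-back }
    where
    q≡xs∷ʳw : q ≡ xs ++ w ∷ []
    q≡xs∷ʳw = trans q≡ (cong (λ t → xs ++ w ∷ t) ys≡[])
    covers′ : (q ++ u ∷ []) ++ concat rest ↭ u ∷ (q ++ concat rest)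
    covers′ = subst (_↭ u ∷ (q ++ concat rest)) (sym (++-assoc q (u ∷ []) (concat rest))) (shift u q (concat rest))
    from-back : ∀ {x y} → Consecutive (q ++ u ∷ []) x y → IsUW x y ⊎ Consecutive q x y
    from-back c with Consecutive-∷ʳ⁻ c
    ... | inj₁ (refl , s , q≡s∷ʳx) = inj₁ (inj₂ (sym (proj₂ (∷ʳ-injective xs s (trans (sym q≡xs∷ʳw) q≡s∷ʳx))) , refl))
    ... | inj₂ c′ = inj₂ c′

  open Extension extension

  reattached : IsDisjointUnionOfPaths G
  reattached = q′ ∷ rest , ↭.trans q′-covers (↭.trans (concat⁺-↭ (↭-sym σ)) covers) , adj⇔consecutive′
    where
    rest⊆paths : ∀ {p} → p ∈ rest → p ∈ paths
    rest⊆paths p∈ = ∈-resp-↭ (↭-sym σ) (there (there p∈))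
    q′⇒adj : ∀ {x y} → Consecutive q′ x y → adj G x y ≡ true
    q′⇒adj c with q′⇒uw⊎q c
    ... | inj₁ (inj₁ (refl , refl)) = uw
    ... | inj₁ (inj₂ (refl , refl)) = adj-flip G uw
    ... | inj₂ c′ = adj∖⇒adj (consecutive⇒adj q∈ c′)
    Consecutive± : List V → V → V → Set
    Consecutive± p x y = Consecutive p x y ⊎ Consecutive p y x
    adj⇔consecutive′ : ∀ x y → adj G x y ≡ true ⇔ (Σ (List V) λ p → p ∈ q′ ∷ rest × Consecutive± p x y)
    adj⇔consecutive′ x y = to , from
      where
      to : adj G x y ≡ true → Σ (List V) λ p → p ∈ q′ ∷ rest × Consecutive± p x y
      to xy with isUW? x y
      ... | yes (inj₁ (refl , refl)) = q′ , here refl , uw-on-q′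
      ... | yes (inj₂ (refl , refl)) = q′ , here refl , Sum.swap uw-on-q′
      ... | no ¬uw with proj₁ (adj∖⇔consecutive x y) (adj⇒adj∖ xy ¬uw)
      ...   | p , p∈ , c with ∈-resp-↭ σ p∈
      ...     | here refl          = ⊥-elim (Sum.[ ¬Consecutive-singleton , ¬Consecutive-singleton ] c)
      ...     | there (here refl)  = q′ , here refl , Sum.map q⇒q′ q⇒q′ c
      ...     | there (there p∈′)  = p , there p∈′ , c
      from : (Σ (List V) λ p → p ∈ q′ ∷ rest × Consecutive± p x y) → adj G x y ≡ true
      from (p , here refl , inj₁ c) = q′⇒adj c
      from (p , here refl , inj₂ c) = adj-flip G (q′⇒adj c)
      from (p , there p∈ , c)       = adj∖⇒adj (proj₂ (adj∖⇔consecutive x y) (p , rest⊆paths p∈ , c))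

Δ≤2 : Graph → Set
Δ≤2 G = ∀ x → deg G x ≤ 2

NoEvenNontrivialComponent : Graph → Set
NoEvenNontrivialComponent G = ∀ x → 1 ≤ deg G x → ¬ EvenComponent G x

Odd∧≤2⇒≡1 : ∀ {k} → Odd k → k ≤ 2 → k ≡ 1
Odd∧≤2⇒≡1 one                _                   = refl
Odd∧≤2⇒≡1 (ss one)           (s≤s (s≤s ()))
Odd∧≤2⇒≡1 (ss (ss _))        (s≤s (s≤s ()))

edgeless⇒paths : ∀ G → (∀ x → deg G x ≡ 0) → IsDisjointUnionOfPaths G
edgeless⇒paths G isolated = map [_] (allFin (n G)) , covers , adj⇔consecutive
  where
  covers : concat (map [_] (allFin (n G))) ↭ allFin (n G)
  covers = subst (_↭ allFin (n G)) (sym (concat-map-[ allFin (n G) ])) ↭.refl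
  adj⇔consecutive : ∀ x y → adj G x y ≡ true ⇔
    (Σ (List (Fin (n G))) λ p → p ∈ map [_] (allFin (n G)) × (Consecutive p x y ⊎ Consecutive p y x))
  adj⇔consecutive x y = (λ xy → contradiction (subst (1 ≤_) (isolated x) (adj⇒1≤deg G xy)) λ ()) , from
    where
    from : (Σ (List (Fin (n G))) λ p → p ∈ map [_] (allFin (n G)) × (Consecutive p x y ⊎ Consecutive p y x)) → adj G x y ≡ true
    from (p , p∈ , c) with ∈-map⁻ [_] p∈
    from (p , p∈ , inj₁ c) | z , _ , refl = ⊥-elim (¬Consecutive-singleton c)
    from (p , p∈ , inj₂ c) | z , _ , refl = ⊥-elim (¬Consecutive-singleton c)

record PendantEdge (G : Graph) : Set where
  field
    u w     : Fin (n G)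
    u≢w     : u ≢ w
    uw      : adj G u w ≡ true
    deg-u≡1 : deg G u ≡ 1

pendantEdge : ∀ G → Δ≤2 G → NoEvenNontrivialComponent G → ∀ x → 1 ≤ deg G x → PendantEdge G
pendantEdge G Δ≤2 no-even x 1≤d with ¬EvenComponent⇒odd G x (no-even x 1≤d)
... | u , _ , odd-u with 1≤deg⇒adj G u (≤-reflexive (sym (Odd∧≤2⇒≡1 odd-u (Δ≤2 u))))
...   | w , uw = record { u = u ; w = w ; u≢w = adj⇒≢ G uw ; uw = uw ; deg-u≡1 = Odd∧≤2⇒≡1 odd-u (Δ≤2 u) }

module RemovePendant (G : Graph) (Δ≤2-G : Δ≤2 G) (no-even : NoEvenNontrivialComponent G) (e : PendantEdge G) where

  open PendantEdge e
  open EdgeDeletion G u w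

  Δ≤2-∖ : Δ≤2 G∖uw
  Δ≤2-∖ x = ≤-trans (deg∖≤deg u≢w uw x) (Δ≤2-G x)

  private
    only-neighbour : ∀ a → adj G u a ≡ true → a ≡ w
    only-neighbour a ua with a ≟ w
    ... | yes a≡w = a≡w
    ... | no a≢w  = contradiction (subst (2 ≤_) deg-u≡1 (2≤deg G ua uw a≢w)) λ { (s≤s ()) }

    edge-avoids-uw : ∀ {a c} → ¬ Connected G∖uw a w → a ≢ u → adj G a c ≡ true → adj G∖uw a c ≡ true
    edge-avoids-uw ¬aw a≢u ac = adj⇒adj∖ ac λ { (inj₁ (a≡u , _)) → a≢u a≡u ; (inj₂ (refl , _)) → ¬aw here }

    walk-avoids-uw : ∀ {a z} → ¬ Connected G∖uw a w → a ≢ u → Connected G a z →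
      Connected G∖uw a z × ¬ Connected G∖uw z w × z ≢ u
    walk-avoids-uw ¬aw a≢u here = here , ¬aw , a≢u
    walk-avoids-uw {a} ¬aw a≢u (there {w = c} ac cz) =
      let (cz∖ , ¬zw , z≢u) = walk-avoids-uw ¬cw c≢u cz in there ac∖ cz∖ , ¬zw , z≢u
      where
      ac∖ : adj G∖uw a c ≡ true
      ac∖ = edge-avoids-uw ¬aw a≢u ac
      ¬cw : ¬ Connected G∖uw c w
      ¬cw cw = ¬aw (there ac∖ cw)
      c≢u : c ≢ u
      c≢u refl with only-neighbour a (adj-flip G ac)
      ... | refl = ¬aw here

  no-even-∖ : NoEvenNontrivialComponent G∖uw
  no-even-∖ y 1≤d even-y with Connected? G∖uw y w
  ... | yes yw = w-odd (deg G∖uw w) refl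
    where
    w-odd : ∀ k → deg G∖uw w ≡ k → ⊥
    w-odd zero d≡0 with deg≡0⇒Connected⇒≡ G∖uw d≡0 (Connected-sym G∖uw yw)
    ... | refl = contradiction (subst (1 ≤_) d≡0 1≤d) λ ()
    w-odd (suc zero)    d≡1 = even-y w yw (subst Odd (sym d≡1) one)
    w-odd (suc (suc k)) d≡  = contradiction (subst (_≤ 1) d≡ (deg∖-w≤1 u≢w uw (Δ≤2-G w))) λ { (s≤s ()) }
  ... | no ¬yw = no-even y (≤-trans 1≤d (deg∖≤deg u≢w uw y)) even-G
    where
    y≢u : y ≢ u
    y≢u refl = contradiction (subst (1 ≤_) (deg∖-u≡0 u≢w uw deg-u≡1) 1≤d) λ ()
    even-G : EvenComponent G y
    even-G z yz odd with walk-avoids-uw ¬yw y≢u yz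
    ... | yz∖ , ¬zw , z≢u = even-y z yz∖ (subst Odd (sym (deg∖-other z≢u λ { refl → ¬zw here })) odd)

Δ≤2⇒paths : ∀ fuel G → ∑ (deg G) ≤ fuel → Δ≤2 G → NoEvenNontrivialComponent G → IsDisjointUnionOfPaths G
Δ≤2⇒paths fuel G bound Δ≤2-G no-even with any? (λ x → 1 ≤? deg G x) | fuel
... | no no-edge | _ = edgeless⇒paths G (λ x → n<1⇒n≡0 (≰⇒> (no-edge ∘ (x ,_))))
... | yes (x , 1≤d) | zero = contradiction (≤-trans 1≤d (≤-trans (∑-≥ (deg G) x) bound)) λ ()
... | yes (x , 1≤d) | suc fuel′ =
  Reattach.reattached G u w u≢w uw deg-u≡1 (Δ≤2-G w) (Δ≤2⇒paths fuel′ G∖uw bound′ Δ≤2-∖ no-even-∖)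
  where
  e = pendantEdge G Δ≤2-G no-even x 1≤d
  open PendantEdge e
  open EdgeDeletion G u w
  open RemovePendant G Δ≤2-G no-even e
  bound′ : ∑ (deg G∖uw) ≤ fuel′
  bound′ = ≤-pred (≤-trans (∑deg∖<∑deg u≢w uw) bound)

-- The handshake lemma

parity-∑-even : ∀ {k} (f : Fin k → ℕ) → (∀ x → parity (f x) ≡ 0ℙ) → parity (∑ f) ≡ 0ℙ
parity-∑-even {zero}  f even = refl
parity-∑-even {suc k} f even =
  trans (ℙ.+-homo-+ (f zero) _) (cong₂ ℙ._+_ (even zero) (parity-∑-even (f ∘ suc) (even ∘ suc)))

-- Off the diagonal the entries of a symmetric matrix pair up.
parity-∑∑-symmetric : ∀ {k} (M : Fin k → Fin k → ℕ) → (∀ x y → M x y ≡ M y x) → (∀ x → M x x ≡ 0) →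
  parity (∑ (λ x → ∑ (M x))) ≡ 0ℙ
parity-∑∑-symmetric {zero}  M sym-M diag = refl
parity-∑∑-symmetric {suc k} M sym-M diag = begin
  parity (∑ (λ x → ∑ (M x)))             ≡⟨ cong parity split ⟩
  parity (R + R + I)                     ≡⟨ ℙ.+-homo-+ (R + R) I ⟩
  parity (R + R) ℙ.+ parity I            ≡⟨ cong (ℙ._+ parity I) (trans (ℙ.+-homo-+ R R) (ℙ.p+p≡0ℙ (parity R))) ⟩
  parity I                               ≡⟨ parity-∑∑-symmetric (λ x y → M (suc x) (suc y)) (λ x y → sym-M (suc x) (suc y)) (diag ∘ suc) ⟩
  0ℙ                                     ∎
  where
  open ≡-Reasoning
  R = ∑ (M zero ∘ suc)
  I = ∑ (λ x → ∑ (M (suc x) ∘ suc))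
  split : ∑ (λ x → ∑ (M x)) ≡ R + R + I
  split = begin
    M zero zero + R + ∑ (λ x → M (suc x) zero + ∑ (M (suc x) ∘ suc))
      ≡⟨ cong₂ (λ d s → d + R + s) (diag zero) (∑-distrib-+ (λ x → M (suc x) zero) _) ⟩
    R + (∑ (λ x → M (suc x) zero) + I)
      ≡⟨ cong (λ s → R + (s + I)) (sum-cong-≗ (λ x → sym-M (suc x) zero)) ⟩
    R + (R + I)
      ≡⟨ +-assoc R R I ⟨
    R + R + I
      ∎

-- Counting the degrees in K twice: edges inside K count twice, edges leaving K once.
module Handshake (G : Graph) (K : Fin (n G) → Bool) where

  boundary : ℕ
  boundary = ∑ (λ x → ∑ (λ y → 𝟙 (K x ∧ not (K y) ∧ adj G x y)))

  private
    inside : Fin (n G) → Fin (n G) → ℕ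
    inside x y = 𝟙 (K x ∧ K y ∧ adj G x y)

    inside-sym : ∀ x y → inside x y ≡ inside y x
    inside-sym x y with K x | K y
    ... | true  | true  = cong 𝟙 (adj-sym G x y)
    ... | true  | false = refl
    ... | false | true  = refl
    ... | false | false = refl

    inside-diag : ∀ x → inside x x ≡ 0
    inside-diag x with K x
    ... | true  = cong 𝟙 (adj-irrefl G x)
    ... | false = refl

    𝟙-split : ∀ a b c → 𝟙 (a ∧ c) ≡ 𝟙 (a ∧ b ∧ c) + 𝟙 (a ∧ not b ∧ c)
    𝟙-split true  true  c = sym (+-identityʳ _)
    𝟙-split true  false c = refl
    𝟙-split false b     c = refl

    degK : Fin (n G) → ℕ
    degK x = if K x then deg G x else 0

    degK≡∑ : ∀ x → degK x ≡ ∑ (λ y → 𝟙 (K x ∧ adj G x y))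
    degK≡∑ x with K x
    ... | true  = deg≡∑ G x
    ... | false = sym (∑-zero {f = λ y → 𝟙 (false ∧ adj G x y)} (λ _ → refl))

    ∑degK≡ : ∑ degK ≡ ∑ (λ x → ∑ (inside x)) + boundary
    ∑degK≡ = begin
      ∑ degK                                             ≡⟨ sum-cong-≗ degK≡∑ ⟩
      ∑ (λ x → ∑ (λ y → 𝟙 (K x ∧ adj G x y)))           ≡⟨ sum-cong-≗ (λ x → trans (sum-cong-≗ (λ y → 𝟙-split (K x) (K y) (adj G x y)))
                                                                                   (∑-distrib-+ (inside x) _)) ⟩
      ∑ (λ x → ∑ (inside x) + ∑ (λ y → 𝟙 (K x ∧ not (K y) ∧ adj G x y))) ≡⟨ ∑-distrib-+ (λ x → ∑ (inside x)) _ ⟩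
      ∑ (λ x → ∑ (inside x)) + boundary                  ∎
      where open ≡-Reasoning

    even-boundary : (∀ x → K x ≡ true → ¬ Odd (deg G x)) → parity boundary ≡ 0ℙ
    even-boundary K-even = begin
      parity boundary                                      ≡⟨ cong (ℙ._+ parity boundary) (parity-∑∑-symmetric inside inside-sym inside-diag) ⟨
      parity (∑ (λ x → ∑ (inside x))) ℙ.+ parity boundary  ≡⟨ ℙ.+-homo-+ (∑ (λ x → ∑ (inside x))) boundary ⟨
      parity (∑ (λ x → ∑ (inside x)) + boundary)           ≡⟨ cong parity ∑degK≡ ⟨
      parity (∑ degK)                                      ≡⟨ parity-∑-even degK degK-even ⟩
      0ℙ                                                   ∎
      where
      open ≡-Reasoning
      degK-even : ∀ x → parity (degK x) ≡ 0ℙ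
      degK-even x with K x in Kx
      ... | true  = ¬Odd⇒parity≡0ℙ (K-even x Kx)
      ... | false = refl

  odd-boundary⇒odd-vertex : parity boundary ≡ 1ℙ → ∃ λ x → K x ≡ true × Odd (deg G x)
  odd-boundary⇒odd-vertex odd with any? (λ x → (K x Bool.≟ true) ×-dec odd? (deg G x))
  ... | yes found = found
  ... | no ¬found with trans (sym (even-boundary (λ x Kx odd-x → ¬found (x , Kx , odd-x)))) odd
  ...   | ()

-- Splits that keep the potential

does⇒ : ∀ {P : Set} (p? : Dec P) → does p? ≡ true → P
does⇒ (yes p) _  = p
does⇒ (no _)  ()

not-does⇒¬ : ∀ {P : Set} (p? : Dec P) → not (does p?) ≡ true → ¬ P
not-does⇒¬ p? ¬p p with trans (sym ¬p) (cong not (dec-true p? p))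
... | ()

module VertexDeletion (G : Graph) (v : Fin (n G)) where

  G-v : Graph
  G-v = record
    { n          = n G
    ; adj        = λ x y → adj G x y ∧ not (does (x ≟ v)) ∧ not (does (y ≟ v))
    ; adj-sym    = λ x y → cong₂ _∧_ (adj-sym G x y) (Bool.∧-comm (not (does (x ≟ v))) _)
    ; adj-irrefl = λ x → cong (_∧ _) (adj-irrefl G x)
    }

  adj-v⇒adj : ∀ {x y} → adj G-v x y ≡ true → adj G x y ≡ true × x ≢ v × y ≢ v
  adj-v⇒adj {x} {y} xy = Bool.∧-conicalˡ a x∉∧y∉ xy , not-does⇒¬ (x ≟ v) (Bool.∧-conicalˡ x∉ y∉ x∉∧y∉≡true) ,
                          not-does⇒¬ (y ≟ v) (Bool.∧-conicalʳ x∉ y∉ x∉∧y∉≡true)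
    where
    a = adj G x y
    x∉ = not (does (x ≟ v))
    y∉ = not (does (y ≟ v))
    x∉∧y∉ = x∉ ∧ y∉
    x∉∧y∉≡true : x∉∧y∉ ≡ true
    x∉∧y∉≡true = Bool.∧-conicalʳ a x∉∧y∉ xy

  adj⇒adj-v : ∀ {x y} → adj G x y ≡ true → x ≢ v → y ≢ v → adj G-v x y ≡ true
  adj⇒adj-v {x} {y} xy x≢v y≢v rewrite xy | dec-false (x ≟ v) x≢v | dec-false (y ≟ v) y≢v = refl

  Connected-v⇒Connected : ∀ {a b} → Connected G-v a b → Connected G a b
  Connected-v⇒Connected here          = here
  Connected-v⇒Connected (there ab bc) = there (proj₁ (adj-v⇒adj ab)) (Connected-v⇒Connected bc)

  Connected-v-avoids : ∀ {a b} → Connected G-v a b → a ≢ v → b ≢ v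
  Connected-v-avoids here          a≢v = a≢v
  Connected-v-avoids (there ab bc) _   = Connected-v-avoids bc (proj₂ (proj₂ (adj-v⇒adj ab)))

  last-edge-into-v : ∀ {x} → Connected G x v → x ≢ v → ∃ λ a → adj G v a ≡ true × Connected G-v a x
  last-edge-into-v here x≢v = contradiction refl x≢v
  last-edge-into-v {x} (there {w = y} xy yv) x≢v with y ≟ v
  ... | yes refl = x , adj-flip G xy , here
  ... | no y≢v with last-edge-into-v yv y≢v
  ...   | a , va , ay = a , va , Connected-trans G-v ay (adj⇒Connected G-v (adj⇒adj-v (adj-flip G xy) y≢v x≢v))

module SplitOff (G : Graph) (v : Fin (n G)) (A : Fin (n G) → Bool) (A⊆N : ∀ y → A y ≡ true → adj G v y ≡ true) where

  B : Fin (n G) → Bool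
  B y = adj G v y ∧ not (A y)

  valid : ValidSplit G v A B
  valid = A⊆N , (λ u → Bool.∧-conicalˡ (adj G v u) (not (A u))) , A∪B
    where
    A∪B : ∀ u → adj G v u ≡ true → A u ≡ true ⊎ B u ≡ true
    A∪B u vu with A u
    ... | true  = inj₁ refl
    ... | false = inj₂ (trans (Bool.∧-identityʳ (adj G v u)) vu)

  open Splitting G v A B valid public
  open VertexDeletion G v

  disjoint : ∀ y → A y ∧ B y ≡ false
  disjoint y with A y
  ... | true  = Bool.∧-zeroʳ (adj G v y)
  ... | false = refl

  deg′-other : ∀ {o} → o ≢ v → deg G′ (suc o) ≡ deg G o
  deg′-other {o} o≢v = trans (deg-other o≢v) (trans (cong (λ b → deg G o + 𝟙 b) (disjoint o)) (+-identityʳ _))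

  ∑⌈deg/2⌉-exact : ∑⌈deg/2⌉ G′ + ⌈ deg G v /2⌉ ≡ ∑⌈deg/2⌉ G + (⌈ |A| /2⌉ + ⌈ |B| /2⌉)
  ∑⌈deg/2⌉-exact = begin
    ∑⌈deg/2⌉ G′ + f v                    ≡⟨ cong (_+ f v) ∑⌈deg/2⌉-split ⟩
    ⌈ |B| /2⌉ + ∑ g + f v                ≡⟨ +-assoc ⌈ |B| /2⌉ (∑ g) (f v) ⟩
    ⌈ |B| /2⌉ + (∑ g + f v)              ≡⟨ cong (⌈ |B| /2⌉ +_) (∑-except-≡ v (λ x x≢v → cong ⌈_/2⌉ (sym (deg′-other x≢v)))) ⟨
    ⌈ |B| /2⌉ + (∑ f + g v)              ≡⟨ cong (λ d → ⌈ |B| /2⌉ + (∑ f + ⌈ d /2⌉)) deg-v₁ ⟩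
    ⌈ |B| /2⌉ + (∑ f + ⌈ |A| /2⌉)        ≡⟨ solve 3 (λ b s a → b :+ (s :+ a) := s :+ (a :+ b)) refl ⌈ |B| /2⌉ (∑ f) ⌈ |A| /2⌉ ⟩
    ∑ f + (⌈ |A| /2⌉ + ⌈ |B| /2⌉)        ∎
    where
    open ≡-Reasoning
    open +-*-Solver
    f g : Fin (n G) → ℕ
    f x = ⌈ deg G x /2⌉
    g x = ⌈ deg G′ (suc x) /2⌉

  lift-G-v : ∀ {x y} → Connected G-v x y → x ≢ v → Connected G′ (suc x) (suc y)
  lift-G-v here          x≢v = here
  lift-G-v (there xz zy) x≢v with adj-v⇒adj xz
  ... | xz′ , _ , z≢v = there (trans (adj′-other x≢v z≢v) xz′) (lift-G-v zy z≢v)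

  B-true : ∀ {q} → adj G v q ≡ true → A q ≡ false → B q ≡ true
  B-true {q} vq Aq rewrite vq | Aq = refl

  reaches-odd : ∀ {t o} → Connected G′ t (suc o) → o ≢ v → Odd (deg G o) → ¬ EvenComponent G′ t
  reaches-odd to o≢v odd even-t = even-t _ to (subst Odd (sym (deg′-other o≢v)) odd)

  module _ {r r′} (N : NumEvenComponents G r) (N′ : NumEvenComponents G′ r′)
           (¬even-v₂ : ¬ EvenComponent G′ zero) (¬even-v₁ : ¬ EvenComponent G′ (suc v)) where

    open Representatives N

    potential′≤potential : ⌈ |A| /2⌉ + ⌈ |B| /2⌉ ≤ ⌈ deg G v /2⌉ → ∑⌈deg/2⌉ G′ + r′ ≤ ∑⌈deg/2⌉ G + r
    potential′≤potential halves≤ = +-mono-≤ S′≤S (≤-trans (r′≤away N′ ¬even-v₂ ¬even-v₁) away≤r)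
      where
      S′≤S : ∑⌈deg/2⌉ G′ ≤ ∑⌈deg/2⌉ G
      S′≤S = +-cancelʳ-≤ ⌈ deg G v /2⌉ _ _
        (subst (_≤ ∑⌈deg/2⌉ G + ⌈ deg G v /2⌉) (sym ∑⌈deg/2⌉-exact) (+-monoʳ-≤ (∑⌈deg/2⌉ G) halves≤))

    potential′≤potential-even : EvenComponent G v → ⌈ |A| /2⌉ + ⌈ |B| /2⌉ ≤ suc ⌈ deg G v /2⌉ → ∑⌈deg/2⌉ G′ + r′ ≤ ∑⌈deg/2⌉ G + r
    potential′≤potential-even even-v halves≤ = begin
      ∑⌈deg/2⌉ G′ + r′                    ≤⟨ +-mono-≤ S′≤S+1 (r′≤away N′ ¬even-v₂ ¬even-v₁) ⟩
      suc (∑⌈deg/2⌉ G) + length away      ≡⟨ +-suc (∑⌈deg/2⌉ G) (length away) ⟨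
      ∑⌈deg/2⌉ G + suc (length away)      ≤⟨ +-monoʳ-≤ (∑⌈deg/2⌉ G) (suc-away≤r even-v) ⟩
      ∑⌈deg/2⌉ G + r                      ∎
      where
      open ≤-Reasoning
      S′≤S+1 : ∑⌈deg/2⌉ G′ ≤ suc (∑⌈deg/2⌉ G)
      S′≤S+1 = +-cancelʳ-≤ ⌈ deg G v /2⌉ _ _
        (subst₂ _≤_ (sym ∑⌈deg/2⌉-exact) (+-suc (∑⌈deg/2⌉ G) ⌈ deg G v /2⌉) (+-monoʳ-≤ (∑⌈deg/2⌉ G) halves≤))

record GoodSplit (G : Graph) (r : ℕ) : Set where
  field
    v          : Fin (n G)
    A B        : Fin (n G) → Bool
    valid      : ValidSplit G v A B
    r′         : ℕ
    N′         : NumEvenComponents (splitGraph G v A B) r′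
    potential≤ : ∑⌈deg/2⌉ (splitGraph G v A B) + r′ ≤ ∑⌈deg/2⌉ G + r

goodSplitOff : ∀ G {r} v (A : Fin (n G) → Bool) (A⊆N : ∀ y → A y ≡ true → adj G v y ≡ true) →
  (∀ {r′} → NumEvenComponents (SplitOff.G′ G v A A⊆N) r′ → ∑⌈deg/2⌉ (SplitOff.G′ G v A A⊆N) + r′ ≤ ∑⌈deg/2⌉ G + r) →
  GoodSplit G r
goodSplitOff G v A A⊆N bound with numEvenComponents (SplitOff.G′ G v A A⊆N)
... | r′ , N′ = record { v = v ; A = A ; B = SplitOff.B G v A A⊆N ; valid = SplitOff.valid G v A A⊆N
                       ; r′ = r′ ; N′ = N′ ; potential≤ = bound N′ }

module _ (G : Graph) (v : Fin (n G)) where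

  private
    V = Fin (n G)

  single : V → V → Bool
  single a y = does (y ≟ a)

  single⊆N : ∀ {a} → adj G v a ≡ true → ∀ y → single a y ≡ true → adj G v y ≡ true
  single⊆N {a} va y y≡a with y ≟ a
  single⊆N va y _  | yes refl = va
  single⊆N va y () | no _

  -- v₁ gets one neighbour: if v lies in an even component, v₁ and v₂ both get odd degree.
  goodSplit-even-component : ∀ {r} → NumEvenComponents G r → 1 ≤ deg G v → EvenComponent G v → GoodSplit G r
  goodSplit-even-component N 1≤d even-v with 1≤deg⇒adj G v 1≤d
  ... | a , va = goodSplitOff G v (single a) (single⊆N va) (λ N′ → potential′≤potential-even N N′ ¬even-v₂ ¬even-v₁ even-v halves≤)
    where
    open SplitOff G v (single a) (single⊆N va)
    |A|≡1 : |A| ≡ 1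
    |A|≡1 = ∑-indicator a
    suc|B|≡d : suc |B| ≡ deg G v
    suc|B|≡d = trans (cong (_+ |B|) (sym |A|≡1)) (|A|+|B|≡deg disjoint)
    ¬even-v₁ : ¬ EvenComponent G′ (suc v)
    ¬even-v₁ even = even (suc v) here (subst Odd (sym (trans deg-v₁ |A|≡1)) one)
    ¬even-v₂ : ¬ EvenComponent G′ zero
    ¬even-v₂ even = even zero here (subst Odd (sym deg-v₂) (¬Odd-suc⇒Odd (subst (¬_ ∘ Odd) (sym suc|B|≡d) (even-v v here))))
    halves≤ : ⌈ |A| /2⌉ + ⌈ |B| /2⌉ ≤ suc ⌈ deg G v /2⌉
    halves≤ = subst₂ (λ a d → ⌈ a /2⌉ + ⌈ |B| /2⌉ ≤ suc ⌈ d /2⌉) (sym |A|≡1) suc|B|≡d (s≤s (⌈n/2⌉-mono (n≤1+n |B|)))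

  module HighDegree {r} (N : NumEvenComponents G r) (3≤d : 3 ≤ deg G v) where

    open VertexDeletion G v

    -- The edges leaving v's component minus v are exactly those at v: an odd number of them
    -- when deg v is odd, so the handshake lemma finds an odd-degree vertex other than v.
    private
      beside-v : V → Bool
      beside-v x = does (Connected? G v x) ∧ not (does (x ≟ v))

      edges-leaving-beside-v : ∀ x → ∑ (λ y → 𝟙 (beside-v x ∧ not (beside-v y) ∧ adj G x y)) ≡ 𝟙 (adj G v x)
      edges-leaving-beside-v x with Connected? G v x
      ... | no ¬vx = trans (∑-zero {f = λ y → 𝟙 (false ∧ not (beside-v y) ∧ adj G x y)} (λ _ → refl))
                           (cong 𝟙 (sym (Bool.¬-not (¬vx ∘ adj⇒Connected G))))
      ... | yes vx with x ≟ v
      ...   | yes refl = trans (∑-zero {f = λ y → 𝟙 (false ∧ not (beside-v y) ∧ adj G v y)} (λ _ → refl))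
                               (cong 𝟙 (sym (adj-irrefl G v)))
      ...   | no x≢v   = trans (∑-single _ v only-v) at-v
        where
        only-v : ∀ y → y ≢ v → 𝟙 (not (beside-v y) ∧ adj G x y) ≡ 0
        only-v y y≢v with adj G x y in xy
        ... | false = cong 𝟙 (Bool.∧-zeroʳ _)
        ... | true rewrite dec-true (Connected? G v y) (Connected-trans G vx (adj⇒Connected G xy))
                         | dec-false (y ≟ v) y≢v = refl
        at-v : 𝟙 (not (beside-v v) ∧ adj G x v) ≡ 𝟙 (adj G v x)
        at-v rewrite dec-true (v ≟ v) refl | Bool.∧-zeroʳ (does (Connected? G v v)) = cong 𝟙 (adj-sym G x v)

      boundary≡deg : Handshake.boundary G beside-v ≡ deg G v
      boundary≡deg = trans (sum-cong-≗ edges-leaving-beside-v) (sym (deg≡∑ G v))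

      odd-vertex-beside-v : Odd (deg G v) → ∃ λ o → Connected G v o × o ≢ v × Odd (deg G o)
      odd-vertex-beside-v odd-v
        with Handshake.odd-boundary⇒odd-vertex G beside-v (trans (cong parity boundary≡deg) (Odd⇒parity≡1ℙ odd-v))
      ... | o , beside , odd-o =
        o , does⇒ (Connected? G v o) (Bool.∧-conicalˡ _ _ beside) , not-does⇒¬ (o ≟ v) (Bool.∧-conicalʳ _ _ beside) , odd-o

    -- v₁ gets a neighbour c ≢ a, and v₂ keeps a, through which it reaches an odd vertex o.
    goodSplit-odd-degree : Odd (deg G v) → GoodSplit G r
    goodSplit-odd-degree odd-v with odd-vertex-beside-v odd-v
    ... | o , vo , o≢v , odd-o with last-edge-into-v (Connected-sym G vo) o≢v
    ...   | a , va , ao with 3≤deg⇒third-neighbour G v 3≤d a a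
    ...     | c , vc , c≢a , _ = goodSplitOff G v (single c) (single⊆N vc) (λ N′ → potential′≤potential N N′ ¬even-v₂ ¬even-v₁ halves≤)
      where
      open SplitOff G v (single c) (single⊆N vc)
      |A|≡1 : |A| ≡ 1
      |A|≡1 = ∑-indicator c
      ¬even-v₁ : ¬ EvenComponent G′ (suc v)
      ¬even-v₁ even = even (suc v) here (subst Odd (sym (trans deg-v₁ |A|≡1)) one)
      ¬even-v₂ : ¬ EvenComponent G′ zero
      ¬even-v₂ = reaches-odd (there (B-true va (dec-false (a ≟ c) (c≢a ∘ sym))) (lift-G-v ao (adj⇒≢ G va ∘ sym))) o≢v odd-o
      suc|B|≡d : suc |B| ≡ deg G v
      suc|B|≡d = trans (cong (_+ |B|) (sym |A|≡1)) (|A|+|B|≡deg disjoint)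
      halves≤ : ⌈ |A| /2⌉ + ⌈ |B| /2⌉ ≤ ⌈ deg G v /2⌉
      halves≤ = ≤-reflexive (begin
        ⌈ |A| /2⌉ + ⌈ |B| /2⌉  ≡⟨ cong (λ a → ⌈ a /2⌉ + ⌈ |B| /2⌉) |A|≡1 ⟩
        suc ⌈ |B| /2⌉          ≡⟨ ⌈suc/2⌉-even |B| (¬Odd⇒parity≡0ℙ (Odd-suc⇒¬Odd (subst Odd (sym suc|B|≡d) odd-v))) ⟨
        ⌈ suc |B| /2⌉          ≡⟨ cong ⌈_/2⌉ suc|B|≡d ⟩
        ⌈ deg G v /2⌉          ∎)
        where open ≡-Reasoning

    record OddReachingNeighbour (a : V) : Set where
      field
        q o   : V
        vq    : adj G v q ≡ true
        q≢a   : q ≢ a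
        qo    : Connected G-v q o
        o≢v   : o ≢ v
        odd-o : Odd (deg G o)

    module EvenDegree (¬odd-v : ¬ Odd (deg G v)) (o₁ : V) (odd-o₁ : Odd (deg G o₁))
                      (a : V) (va : adj G v a ≡ true) (ao₁ : Connected G-v a o₁) where

      private
        odd⇒≢v : ∀ {o} → Odd (deg G o) → o ≢ v
        odd⇒≢v odd refl = ¬odd-v odd

        a≢v : a ≢ v
        a≢v = adj⇒≢ G va ∘ sym

      -- If a is the only neighbour of v in its component of G - v, then va is the only edge
      -- leaving the vertices of v's component that G - v separates from a.
      module AloneInComponent (alone : ¬ (∃ λ a′ → adj G v a′ ≡ true × a′ ≢ a × Connected G-v a a′)) where

        private
          K : V → Bool
          K x = does (Connected? G v x) ∧ not (does (Connected? G-v a x))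

          K-v : K v ≡ true
          K-v rewrite dec-true (Connected? G v v) here | dec-false (Connected? G-v a v) (λ av → Connected-v-avoids av a≢v refl) = refl

          K-a : K a ≡ false
          K-a rewrite dec-true (Connected? G-v a a) here = Bool.∧-zeroʳ _

          leaving-elsewhere : ∀ x → x ≢ v → ∑ (λ y → 𝟙 (K x ∧ not (K y) ∧ adj G x y)) ≡ 0
          leaving-elsewhere x x≢v = ∑-zero none
            where
            none : ∀ y → 𝟙 (K x ∧ not (K y) ∧ adj G x y) ≡ 0
            none y with Connected? G v x
            ... | no _ = refl
            ... | yes vx with Connected? G-v a x
            ...   | yes _ = refl
            ...   | no ¬ax with adj G x y in xy
            ...     | false = cong 𝟙 (Bool.∧-zeroʳ (not (K y)))
            ...     | true with Connected? G v y | Connected? G-v a y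
            ...       | no ¬vy | _     = contradiction (Connected-trans G vx (adj⇒Connected G xy)) ¬vy
            ...       | yes _  | no _  = refl
            ...       | yes _  | yes ay = contradiction (Connected-trans G-v ay (adj⇒Connected G-v yx)) ¬ax
              where
              yx : adj G-v y x ≡ true
              yx = adj⇒adj-v (adj-flip G xy) (Connected-v-avoids ay a≢v) x≢v

          leaving-v : ∑ (λ y → 𝟙 (K v ∧ not (K y) ∧ adj G v y)) ≡ 1
          leaving-v = trans (∑-single _ a only-a) at-a
            where
            only-a : ∀ y → y ≢ a → 𝟙 (K v ∧ not (K y) ∧ adj G v y) ≡ 0
            only-a y y≢a with adj G v y in vy
            ... | false = cong 𝟙 (trans (cong (K v ∧_) (Bool.∧-zeroʳ (not (K y)))) (Bool.∧-zeroʳ (K v)))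
            ... | true with Connected? G v y | Connected? G-v a y
            ...   | no ¬vy | _    = contradiction (adj⇒Connected G vy) ¬vy
            ...   | yes _  | yes ay = contradiction (y , vy , y≢a , ay) alone
            ...   | yes _  | no _   = cong 𝟙 (Bool.∧-zeroʳ (K v))
            at-a : 𝟙 (K v ∧ not (K a) ∧ adj G v a) ≡ 1
            at-a rewrite K-a | va | K-v = refl

          boundary≡1 : Handshake.boundary G K ≡ 1
          boundary≡1 = trans (∑-single _ v leaving-elsewhere) leaving-v

        neighbour : OddReachingNeighbour a
        neighbour with Handshake.odd-boundary⇒odd-vertex G K (cong parity boundary≡1)
        ... | x , Kx , odd-x with last-edge-into-v (Connected-sym G (does⇒ (Connected? G v x) (Bool.∧-conicalˡ _ _ Kx))) (odd⇒≢v odd-x)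
        ...   | q , vq , qx = record { q = q ; o = x ; vq = vq ; q≢a = q≢a ; qo = qx ; o≢v = odd⇒≢v odd-x ; odd-o = odd-x }
          where
          ¬ax : ¬ Connected G-v a x
          ¬ax = not-does⇒¬ (Connected? G-v a x) (Bool.∧-conicalʳ _ _ Kx)
          q≢a : q ≢ a
          q≢a refl = ¬ax qx

      oddReachingNeighbour : OddReachingNeighbour a
      oddReachingNeighbour with any? (λ a′ → (adj G v a′ Bool.≟ true) ×-dec (¬? (a′ ≟ a) ×-dec Connected? G-v a a′))
      ... | yes (a′ , va′ , a′≢a , aa′) = record
        { q = a′ ; o = o₁ ; vq = va′ ; q≢a = a′≢a ; qo = Connected-trans G-v (Connected-sym G-v aa′) ao₁
        ; o≢v = odd⇒≢v odd-o₁ ; odd-o = odd-o₁ }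
      ... | no alone = AloneInComponent.neighbour alone

      -- v₁ gets a and a third neighbour c, v₂ keeps q; through a and q both reach odd vertices.
      goodSplit : GoodSplit G r
      goodSplit with oddReachingNeighbour
      ... | record { q = q ; o = o₂ ; vq = vq ; q≢a = q≢a ; qo = qo₂ ; o≢v = o₂≢v ; odd-o = odd-o₂ }
        with 3≤deg⇒third-neighbour G v 3≤d a q
      ...   | c , vc , c≢a , c≢q = goodSplitOff G v pair pair⊆N (λ N′ → potential′≤potential N N′ ¬even-v₂ ¬even-v₁ halves≤)
        where
        pair : V → Bool
        pair y = does (y ≟ a) ∨ does (y ≟ c)
        pair⊆N : ∀ y → pair y ≡ true → adj G v y ≡ true
        pair⊆N y y∈ with y ≟ a | y ≟ c
        pair⊆N y _  | yes refl | _        = va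
        pair⊆N y _  | no _     | yes refl = vc
        pair⊆N y () | no _     | no _
        open SplitOff G v pair pair⊆N
        |A|≡2 : |A| ≡ 2
        |A|≡2 = trans (sum-cong-≗ split-pair)
                  (trans (∑-distrib-+ (𝟙 ∘ single a) (𝟙 ∘ single c)) (cong₂ _+_ (∑-indicator a) (∑-indicator c)))
          where
          split-pair : ∀ y → 𝟙 (pair y) ≡ 𝟙 (single a y) + 𝟙 (single c y)
          split-pair y with y ≟ a | y ≟ c
          ... | yes refl | yes refl = contradiction refl c≢a
          ... | yes refl | no _     = refl
          ... | no _     | yes refl = refl
          ... | no _     | no _     = refl
        ¬even-v₁ : ¬ EvenComponent G′ (suc v)
        ¬even-v₁ = reaches-odd (there (trans (adj′-v₁ a≢v) (cong (_∨ does (a ≟ c)) (dec-true (a ≟ a) refl))) (lift-G-v ao₁ a≢v))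
                               (odd⇒≢v odd-o₁) odd-o₁
        ¬even-v₂ : ¬ EvenComponent G′ zero
        ¬even-v₂ = reaches-odd (there (B-true vq (cong₂ _∨_ (dec-false (q ≟ a) q≢a) (dec-false (q ≟ c) (c≢q ∘ sym))))
                                      (lift-G-v qo₂ (adj⇒≢ G vq ∘ sym)))
                               o₂≢v odd-o₂
        halves≤ : ⌈ |A| /2⌉ + ⌈ |B| /2⌉ ≤ ⌈ deg G v /2⌉
        halves≤ = ≤-reflexive (trans (cong (λ a → ⌈ a /2⌉ + ⌈ |B| /2⌉) |A|≡2)
                                     (cong ⌈_/2⌉ (trans (cong (_+ |B|) (sym |A|≡2)) (|A|+|B|≡deg disjoint))))

    goodSplit-high-degree : ¬ EvenComponent G v → GoodSplit G r
    goodSplit-high-degree ¬even-v with odd? (deg G v)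
    ... | yes odd-v = goodSplit-odd-degree odd-v
    ... | no ¬odd-v with ¬EvenComponent⇒odd G v ¬even-v
    ...   | o₁ , vo₁ , odd-o₁ with last-edge-into-v (Connected-sym G vo₁) (λ { refl → ¬odd-v odd-o₁ })
    ...     | a , va , ao₁ = EvenDegree.goodSplit ¬odd-v o₁ odd-o₁ a va ao₁

-- The formula

-- Opened only here: the prefix +_ would make sections such as (x +_) on ℕ ambiguous.
open ℤ using (+_)

foldr-ceilHalfMinusOne : ∀ {k} {A : Set} (g : Fin k → A) (d : A → ℕ) →
  foldr ℤ._+_ (+ 0) (map (ceilHalfMinusOne ∘ d) (tabulate g)) ≡ + ∑ (λ x → ⌈ d (g x) /2⌉) ℤ.- + k
foldr-ceilHalfMinusOne {zero}  g d = refl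
foldr-ceilHalfMinusOne {suc k} g d = begin
  ceilHalfMinusOne (d (g zero)) ℤ.+ foldr ℤ._+_ (+ 0) (map (ceilHalfMinusOne ∘ d) (tabulate (g ∘ suc)))
    ≡⟨ cong₂ (λ h t → (+ h ℤ.- + 1) ℤ.+ t) ([n+1]/2≡⌈n/2⌉ (d (g zero))) (foldr-ceilHalfMinusOne (g ∘ suc) d) ⟩
  (+ h ℤ.- + 1) ℤ.+ (+ t ℤ.- + k)
    ≡⟨ solve 3 (λ h t k → (h :- con (+ 1)) :+ (t :- k) := (h :+ t) :- (con (+ 1) :+ k)) refl (+ h) (+ t) (+ k) ⟩
  (+ h ℤ.+ + t) ℤ.- (+ 1 ℤ.+ + k)
    ≡⟨ cong₂ ℤ._-_ (ℤₚ.pos-+ h t) (ℤₚ.pos-+ 1 k) ⟨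
  + (h ℕ.+ t) ℤ.- + suc k
    ∎
  where
  open ≡-Reasoning
  open ℤ-Solver.+-*-Solver
  h = ⌈ d (g zero) /2⌉
  t = ∑ (λ x → ⌈ d (g (suc x)) /2⌉)

splitFormula-from-potential : ∀ G r m → ∑⌈deg/2⌉ G ℕ.+ r ≡ n G ℕ.+ m → + m ≡ splitFormula G r
splitFormula-from-potential G r m Φ≡ = sym (begin
  splitFormula G r                  ≡⟨ cong (ℤ._+ + r) (foldr-ceilHalfMinusOne id (deg G)) ⟩
  (+ S ℤ.- + n G) ℤ.+ + r           ≡⟨ solve 3 (λ s k r → (s :- k) :+ r := (s :+ r) :- k) refl (+ S) (+ n G) (+ r) ⟩
  (+ S ℤ.+ + r) ℤ.- + n G           ≡⟨ cong (ℤ._- + n G) (trans (sym (ℤₚ.pos-+ S r)) (cong +_ Φ≡)) ⟩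
  + (n G ℕ.+ m) ℤ.- + n G           ≡⟨ cong (ℤ._- + n G) (ℤₚ.pos-+ (n G) m) ⟩
  (+ n G ℤ.+ + m) ℤ.- + n G         ≡⟨ solve 2 (λ k m → (k :+ m) :- k := m) refl (+ n G) (+ m) ⟩
  + m                               ∎)
  where
  open ≡-Reasoning
  open ℤ-Solver.+-*-Solver
  S = ∑⌈deg/2⌉ G

-- Splitting down to paths

goodSplit⊎paths : ∀ G {r} → NumEvenComponents G r → GoodSplit G r ⊎ IsDisjointUnionOfPaths G
goodSplit⊎paths G N with any? (λ v → (1 ≤? deg G v) ×-dec EvenComponent? G v)
... | yes (v , 1≤d , even-v) = inj₁ (goodSplit-even-component G v N 1≤d even-v)
... | no ¬even with any? (λ v → 3 ≤? deg G v)
...   | yes (v , 3≤d) = inj₁ (HighDegree.goodSplit-high-degree G v N 3≤d λ even-v → ¬even (v , ≤-trans (s≤s z≤n) 3≤d , even-v))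
...   | no ¬high = inj₂ (Δ≤2⇒paths _ G ≤-refl Δ≤2-G λ x 1≤d even → ¬even (x , 1≤d , even))
  where
  Δ≤2-G : Δ≤2 G
  Δ≤2-G x = ≤-pred (≰⇒> (¬high ∘ (x ,_)))

potential-preserved : ∀ {G r} → NumEvenComponents G r → (good : GoodSplit G r) →
  let open GoodSplit good in ∑⌈deg/2⌉ (splitGraph G v A B) + r′ ≡ ∑⌈deg/2⌉ G + r
potential-preserved {G} N good = ≤-antisym potential≤ (PotentialMonotone.potential-mono G v A B valid N N′)
  where open GoodSplit good

-- Each good split lowers Φ - n by exactly one, so m = Φ - n of them reach a union of paths.
splitToPaths : ∀ m G {r} → NumEvenComponents G r → ∑⌈deg/2⌉ G + r ≡ n G + m →
  Σ Graph λ H → SplitSeq G m H × IsDisjointUnionOfPaths H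
splitToPaths m G N Φ≡ with goodSplit⊎paths G N
... | inj₂ paths = G , subst (λ k → SplitSeq G k G) (sym m≡0) done , paths
  where
  m≡0 : m ≡ 0
  m≡0 = n≤0⇒n≡0 (+-cancelˡ-≤ (n G) m 0 (subst₂ _≤_ Φ≡ (sym (+-identityʳ (n G))) (PathUnion.∑⌈deg/2⌉+r≤n G paths N)))
... | inj₁ good = via-split m (trans (potential-preserved N good) Φ≡)
  where
  open GoodSplit good
  via-split : ∀ m → ∑⌈deg/2⌉ (splitGraph G v A B) + r′ ≡ n G + m → Σ Graph λ H → SplitSeq G m H × IsDisjointUnionOfPaths H
  via-split zero     Φ′≡ = contradiction (subst (suc (n G) ≤_) (trans Φ′≡ (+-identityʳ (n G))) (n≤∑⌈deg/2⌉+r _ N′)) 1+n≰n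
  via-split (suc m′) Φ′≡ with splitToPaths m′ (splitGraph G v A B) N′ (trans Φ′≡ (+-suc (n G) m′))
  ... | H , splits , paths = H , step v A B valid splits , paths

theorem2 : (G : Graph) (r : ℕ) → NumEvenComponents G r →
    Σ ℕ λ m →
      (+ m ≡ splitFormula G r) ×
      (Σ Graph λ H → SplitSeq G m H × IsDisjointUnionOfPaths H) ×
      (∀ k H → SplitSeq G k H → IsDisjointUnionOfPaths H → m ≤ k)
theorem2 G r N = m , splitFormula-from-potential G r m Φ≡ , splitToPaths m G N Φ≡ , minimal
  where
  m = ∑⌈deg/2⌉ G + r ∸ n G
  Φ≡ : ∑⌈deg/2⌉ G + r ≡ n G + m
  Φ≡ = sym (m+[n∸m]≡n (n≤∑⌈deg/2⌉+r G N))
  minimal : ∀ k H → SplitSeq G k H → IsDisjointUnionOfPaths H → m ≤ k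
  minimal k H splits paths =
    +-cancelˡ-≤ (n G) m k (subst (_≤ n G + k) Φ≡ (∑⌈deg/2⌉+r≤n+k splits (PathUnion.∑⌈deg/2⌉+r≤n H paths) N))
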